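{- Let $w$ be a word in the alphabet $\{1,\dots,q\}$. Then $\mathtt{Heckeshape}(w)=(q,q-1,\dots,2,1)$ if and only if $W(w)=w_0$, where $w_0\in S_{q+1}$ is the longest permutation $i\mapsto q+2-i$.
   Context: The 0-Hecke monoid is the quotient of the free monoid on $\{1,\dots,q\}$ by the relations $i\,i\equiv i$, $i\,j\,i\equiv j\,i\,j$, and $i\,j\equiv j\,i$ for $|i-j|\ge2$. Identifying $i$ with $s_i=(i\ i+1)\in S_{q+1}$, every word $w$ is equivalent to a reduced word of a unique permutation $W(w)\in S_{q+1}$. An increasing tableau is a filling of a Young diagram (English notation) strictly increasing along rows and columns. Hecke insertion of $x$ into an increasing tableau $T$: insert $x$ into the first row; inserting a value $x$ into a row $R$ (an empty row below the last row is allowed): if $x$ is $\ge$ every entry of $R$, append a box containing $x$ at the end of $R$ if this yields an increasing tableau, otherwise leave the tableau unchanged, and stop. Otherwise let $y$ be the smallest entry of $R$ strictly greater than $x$; replace $y$ by $x$ if this yields an increasing tableau; in either case insert $y$ into the next row. $\mathtt{Heckeshape}(w)$ is the shape of $((\emptyset\leftarrow w_1)\leftarrow w_2)\cdots\leftarrow w_n$. -}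

module Defs where

open import Data.Nat using (ℕ; zero; suc; _∸_; _<_; _≤_; _<ᵇ_; _≤ᵇ_; _≡ᵇ_)
open import Data.Bool using (Bool; true; false; if_then_else_; _∧_)
open import Data.List using (List; []; _∷_; _++_; [_]; length; map; filter; foldl; reverse; upTo)
open import Data.List.Relation.Unary.All using (All)
open import Data.Product using (_×_; ∃-syntax)
open import Relation.Binary.PropositionalEquality using (_≡_; _≢_)

InAlphabet : ℕ → List ℕ → Set
InAlphabet q w = All (λ a → 1 ≤ a × a ≤ q) w

Far : ℕ → ℕ → Set
Far i j = (2 Data.Nat.+ i ≤ j) Data.Sum.⊎ (2 Data.Nat.+ j ≤ i)
  where import Data.Sum

data _≈H_ : List ℕ → List ℕ → Set where
  idem   : ∀ u v i → (u ++ i ∷ i ∷ v) ≈H (u ++ i ∷ v)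
  braid  : ∀ u v i j → (u ++ i ∷ j ∷ i ∷ v) ≈H (u ++ j ∷ i ∷ j ∷ v)
  comm   : ∀ u v i j → Far i j → (u ++ i ∷ j ∷ v) ≈H (u ++ j ∷ i ∷ v)
  ≈refl  : ∀ u → u ≈H u
  ≈sym   : ∀ {u v} → u ≈H v → v ≈H u
  ≈trans : ∀ {u v x} → u ≈H v → v ≈H x → u ≈H x

-- Permutations of {1,…,q+1} in one-line notation (a list of length q+1).

identityPerm : ℕ → List ℕ
identityPerm q = map suc (upTo (suc q))

-- swap the entries at 0-indexed positions k and k+1
swapAt : ℕ → List ℕ → List ℕ
swapAt zero    (a ∷ b ∷ l) = b ∷ a ∷ l
swapAt (suc k) (a ∷ l)     = a ∷ swapAt k l
swapAt _       l           = l

-- the product s_{w₁} s_{w₂} ⋯ s_{wₙ} ∈ S_{q+1}, s_i = (i i+1), in one-line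
-- notation: right multiplication by s_i swaps the entries at positions i, i+1.
permOf : ℕ → List ℕ → List ℕ
permOf q w = foldl (λ π i → swapAt (i ∸ 1) π) (identityPerm q) w

longestPerm : ℕ → List ℕ
longestPerm q = reverse (identityPerm q)

Reduced : ℕ → List ℕ → Set
Reduced q u = InAlphabet q u ×
  (∀ v → InAlphabet q v → length v < length u → permOf q v ≢ permOf q u)

-- W(w) = w₀ : w is 0-Hecke-equivalent to a reduced word of w₀
WisLongest : ℕ → List ℕ → Set
WisLongest q w = ∃[ v ] (Reduced q v × permOf q v ≡ longestPerm q × w ≈H v)

-- Tableaux: list of rows (English notation), each row a list of entries.

Tableau : Set
Tableau = List (List ℕ)

rowIncreasing : List ℕ → Bool
rowIncreasing []          = true
rowIncreasing (a ∷ [])    = true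
rowIncreasing (a ∷ b ∷ l) = (a <ᵇ b) ∧ rowIncreasing (b ∷ l)

colsIncreasing : List ℕ → List ℕ → Bool
colsIncreasing _       []      = true
colsIncreasing []      (_ ∷ _) = false
colsIncreasing (a ∷ r) (b ∷ s) = (a <ᵇ b) ∧ colsIncreasing r s

nonEmpty : List ℕ → Bool
nonEmpty []      = false
nonEmpty (_ ∷ _) = true

-- increasing tableau of Young-diagram shape (all rows nonempty,
-- row lengths weakly decreasing, rows and columns strictly increasing)
isIncreasing : Tableau → Bool
isIncreasing []            = true
isIncreasing (r ∷ [])      = nonEmpty r ∧ rowIncreasing r
isIncreasing (r ∷ s ∷ t)   =
  nonEmpty r ∧ rowIncreasing r ∧ colsIncreasing r s ∧ isIncreasing (s ∷ t)

-- row r of T, or the empty row if r is beyond the last row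
getRow : ℕ → Tableau → List ℕ
getRow _       []      = []
getRow zero    (R ∷ _) = R
getRow (suc r) (_ ∷ T) = getRow r T

-- set row r of T (r = number of rows appends a new row)
setRow : ℕ → List ℕ → Tableau → Tableau
setRow zero    R []      = R ∷ []
setRow zero    R (_ ∷ T) = R ∷ T
setRow (suc r) R []      = []
setRow (suc r) R (S ∷ T) = S ∷ setRow r R T

minimumWith : ℕ → List ℕ → ℕ
minimumWith m []      = m
minimumWith m (a ∷ l) = minimumWith (if a <ᵇ m then a else m) l

-- smallest entry of R strictly greater than x (R assumed to have one)
smallestAbove : ℕ → List ℕ → ℕ
smallestAbove x R with filter (λ e → Relation.Nullary.Decidable.Core.T? (x <ᵇ e)) R
  where import Relation.Nullary.Decidable.Core
... | []      = x
... | (a ∷ l) = minimumWith a l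

allLeq : ℕ → List ℕ → Bool
allLeq x []      = true
allLeq x (e ∷ R) = (e ≤ᵇ x) ∧ allLeq x R

keepIfIncreasing : Tableau → Tableau → Tableau
keepIfIncreasing T T' = if isIncreasing T' then T' else T

insertRow : ℕ → ℕ → ℕ → Tableau → Tableau
insertRow zero       r x T = T
insertRow (suc fuel) r x T with allLeq x (getRow r T)
... | true  = keepIfIncreasing T (setRow r (getRow r T ++ [ x ]) T)
... | false =
  let R  = getRow r T
      y  = smallestAbove x R
      T' = keepIfIncreasing T (setRow r (map (λ e → if e ≡ᵇ y then x else e) R) T)
  in insertRow fuel (suc r) y T'

-- Hecke insertion T ← x (fuel: one more than the number of rows suffices,
-- since the row below the last one is empty and insertion stops there)
heckeInsert : Tableau → ℕ → Tableau
heckeInsert T x = insertRow (suc (length T)) 0 x T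

heckeTableau : List ℕ → Tableau
heckeTableau w = foldl heckeInsert [] w

heckeShape : List ℕ → List ℕ
heckeShape w = map length (heckeTableau w)

staircase : ℕ → List ℕ
staircase zero    = []
staircase (suc q) = suc q ∷ staircase q

module Submission where

open import Defs
open import Data.Bool using (Bool; true; false; if_then_else_; _∧_; T)
open import Data.Bool.Properties using (T-≡; T-∧)
open import Data.Empty using (⊥-elim)
open import Data.List using (List; []; _∷_; _++_; [_]; length; map; filter; foldl; reverse; upTo; applyUpTo)
open import Data.List.Properties
  using (++-assoc; ++-identityʳ; foldl-++; length-++; map-++; reverse-++; unfold-reverse;
         length-reverse; upTo-∷ʳ; map-upTo; filter-++; filter-all; filter-none; map-id-local)
open import Data.List.Relation.Unary.All as All using (All; []; _∷_)
import Data.List.Relation.Unary.All.Properties as AllP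
open import Data.Nat using (ℕ; zero; suc; _+_; _∸_; _≤_; _<_; z≤n; s≤s; _<ᵇ_; _≤ᵇ_; _≡ᵇ_; _⊔_; _⊓_)
open import Data.Nat.Properties
open import Data.Nat.ListAction using (sum)
open import Data.Product using (∃; _×_; _,_; proj₁; proj₂)
open import Data.Sum using (_⊎_; inj₁; inj₂)
open import Data.Unit using (⊤; tt)
open import Function.Bundles using (_⇔_; mk⇔; Equivalence)
open import Relation.Binary using (tri<; tri≈; tri>)
open import Relation.Binary.PropositionalEquality
  using (_≡_; _≢_; refl; sym; trans; cong; cong₂; subst; subst₂; ≢-sym; module ≡-Reasoning)
open import Relation.Nullary using (¬_; yes; no)
open import Relation.Nullary.Decidable.Core using (T?)

-- (A) The 0-Hecke equivalence as a congruence

≡⇒≈H : ∀ {u v} → u ≡ v → u ≈H v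
≡⇒≈H {u} refl = ≈refl u

++-regroup : ∀ (a u m b : List ℕ) → a ++ (u ++ m) ++ b ≡ (a ++ u) ++ (m ++ b)
++-regroup a u m b = trans (cong (a ++_) (++-assoc u m b)) (sym (++-assoc a u (m ++ b)))

≈H-context : ∀ a b {u v} → u ≈H v → (a ++ u ++ b) ≈H (a ++ v ++ b)
≈H-context a b (idem u v i) =
  subst₂ _≈H_ (sym (++-regroup a u (i ∷ i ∷ v) b)) (sym (++-regroup a u (i ∷ v) b)) (idem (a ++ u) (v ++ b) i)
≈H-context a b (braid u v i j) =
  subst₂ _≈H_ (sym (++-regroup a u (i ∷ j ∷ i ∷ v) b)) (sym (++-regroup a u (j ∷ i ∷ j ∷ v) b)) (braid (a ++ u) (v ++ b) i j)
≈H-context a b (comm u v i j far) =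
  subst₂ _≈H_ (sym (++-regroup a u (i ∷ j ∷ v) b)) (sym (++-regroup a u (j ∷ i ∷ v) b)) (comm (a ++ u) (v ++ b) i j far)
≈H-context a b (≈refl u)     = ≈refl _
≈H-context a b (≈sym p)      = ≈sym (≈H-context a b p)
≈H-context a b (≈trans p q)  = ≈trans (≈H-context a b p) (≈H-context a b q)

≈H-prefix : ∀ a {u v} → u ≈H v → (a ++ u) ≈H (a ++ v)
≈H-prefix a {u} {v} p =
  subst₂ _≈H_ (cong (a ++_) (++-identityʳ u)) (cong (a ++_) (++-identityʳ v)) (≈H-context a [] p)

≈H-suffix : ∀ b {u v} → u ≈H v → (u ++ b) ≈H (v ++ b)
≈H-suffix b p = ≈H-context [] b p

infixr 2 _≈⟨_⟩_ _≡≈⟨_⟩_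
infix 3 _≈∎
_≈⟨_⟩_ : ∀ u {v w} → u ≈H v → v ≈H w → u ≈H w
u ≈⟨ p ⟩ q = ≈trans p q
_≡≈⟨_⟩_ : ∀ u {v w} → u ≡ v → v ≈H w → u ≈H w
u ≡≈⟨ p ⟩ q = ≈trans (≡⇒≈H p) q
_≈∎ : ∀ u → u ≈H u
u ≈∎ = ≈refl u

commute-past : ∀ a x U b → All (Far x) U → (a ++ x ∷ U ++ b) ≈H (a ++ U ++ x ∷ b)
commute-past a x []      b []         = ≈refl _
commute-past a x (e ∷ U) b (far ∷ fs) =
  ≈trans (comm a (U ++ b) x e far)
    (subst₂ _≈H_ (++-assoc a [ e ] (x ∷ U ++ b)) (++-assoc a [ e ] (U ++ x ∷ b))
      (commute-past (a ++ [ e ]) x U b fs))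

-- The generating relations only repeat or reorder letters, so a property of
-- all letters is invariant under ≈H (used for the alphabet and for positivity).
≈H-preserves-All : ∀ {P : ℕ → Set} {u v} → u ≈H v → All P u → All P v
≈H-reflects-All  : ∀ {P : ℕ → Set} {u v} → u ≈H v → All P v → All P u
≈H-preserves-All (idem u v i) p with AllP.++⁻ u p
... | pu , (pi ∷ _ ∷ pv) = AllP.++⁺ pu (pi ∷ pv)
≈H-preserves-All (braid u v i j) p with AllP.++⁻ u p
... | pu , (pi ∷ pj ∷ _ ∷ pv) = AllP.++⁺ pu (pj ∷ pi ∷ pj ∷ pv)
≈H-preserves-All (comm u v i j _) p with AllP.++⁻ u p
... | pu , (pi ∷ pj ∷ pv) = AllP.++⁺ pu (pj ∷ pi ∷ pv)
≈H-preserves-All (≈refl u) p = p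
≈H-preserves-All (≈sym q) p = ≈H-reflects-All q p
≈H-preserves-All (≈trans q r) p = ≈H-preserves-All r (≈H-preserves-All q p)
≈H-reflects-All (idem u v i) p with AllP.++⁻ u p
... | pu , (pi ∷ pv) = AllP.++⁺ pu (pi ∷ pi ∷ pv)
≈H-reflects-All (braid u v i j) p with AllP.++⁻ u p
... | pu , (pj ∷ pi ∷ _ ∷ pv) = AllP.++⁺ pu (pi ∷ pj ∷ pi ∷ pv)
≈H-reflects-All (comm u v i j _) p with AllP.++⁻ u p
... | pu , (pj ∷ pi ∷ pv) = AllP.++⁺ pu (pi ∷ pj ∷ pv)
≈H-reflects-All (≈refl u) p = p
≈H-reflects-All (≈sym q) p = ≈H-preserves-All q p
≈H-reflects-All (≈trans q r) p = ≈H-reflects-All q (≈H-reflects-All r p)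

-- (B) The Demazure action of words on lists

-- The Demazure operator at 0-indexed position k: put the entries at positions
-- k, k+1 into decreasing order.
sortAt : ℕ → List ℕ → List ℕ
sortAt zero    (a ∷ b ∷ l) = a ⊔ b ∷ a ⊓ b ∷ l
sortAt (suc k) (a ∷ l)     = a ∷ sortAt k l
sortAt zero    l           = l
sortAt (suc k) []          = []

resort-max : ∀ a b → (a ⊔ b) ⊔ (a ⊓ b) ≡ a ⊔ b
resort-max a b = m≥n⇒m⊔n≡m (m⊓n≤m⊔n a b)

resort-min : ∀ a b → (a ⊔ b) ⊓ (a ⊓ b) ≡ a ⊓ b
resort-min a b = m≥n⇒m⊓n≡n (m⊓n≤m⊔n a b)

sortAt-idem : ∀ k π → sortAt k (sortAt k π) ≡ sortAt k π
sortAt-idem zero    (a ∷ b ∷ l) =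
  cong₂ (λ u v → u ∷ v ∷ l) (resort-max a b) (resort-min a b)
sortAt-idem zero    []          = refl
sortAt-idem zero    (a ∷ [])    = refl
sortAt-idem (suc k) []          = refl
sortAt-idem (suc k) (a ∷ l)     = cong (a ∷_) (sortAt-idem k l)

sortAt-comm : ∀ k d π → sortAt (2 + k + d) (sortAt k π) ≡ sortAt k (sortAt (2 + k + d) π)
sortAt-comm zero    d (a ∷ b ∷ l) = refl
sortAt-comm zero    d []          = refl
sortAt-comm zero    d (a ∷ [])    = refl
sortAt-comm (suc k) d []          = refl
sortAt-comm (suc k) d (a ∷ l)     = cong (a ∷_) (sortAt-comm k d l)

-- On three entries a, b, c both sides of the braid relation produce
-- max, median, min; the median is the lattice expression in e₂.
sortAt-braid : ∀ k π → sortAt k (sortAt (suc k) (sortAt k π)) ≡ sortAt (suc k) (sortAt k (sortAt (suc k) π))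
sortAt-braid zero (a ∷ b ∷ c ∷ l) = cong₂ _∷_ e₁ (cong₂ _∷_ e₂ (cong (_∷ l) e₃))
  where
  open ≡-Reasoning
  e₁ : (a ⊔ b) ⊔ ((a ⊓ b) ⊔ c) ≡ a ⊔ (b ⊔ c)
  e₁ = begin
    (a ⊔ b) ⊔ ((a ⊓ b) ⊔ c) ≡⟨ sym (⊔-assoc (a ⊔ b) (a ⊓ b) c) ⟩
    ((a ⊔ b) ⊔ (a ⊓ b)) ⊔ c ≡⟨ cong (_⊔ c) (resort-max a b) ⟩
    (a ⊔ b) ⊔ c             ≡⟨ ⊔-assoc a b c ⟩
    a ⊔ (b ⊔ c)             ∎
  e₂ : (a ⊔ b) ⊓ ((a ⊓ b) ⊔ c) ≡ (a ⊓ (b ⊔ c)) ⊔ (b ⊓ c)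
  e₂ = begin
    (a ⊔ b) ⊓ ((a ⊓ b) ⊔ c)             ≡⟨ ⊓-distribˡ-⊔ (a ⊔ b) (a ⊓ b) c ⟩
    ((a ⊔ b) ⊓ (a ⊓ b)) ⊔ ((a ⊔ b) ⊓ c) ≡⟨ cong₂ _⊔_ (resort-min a b) (⊓-distribʳ-⊔ c a b) ⟩
    (a ⊓ b) ⊔ ((a ⊓ c) ⊔ (b ⊓ c))       ≡⟨ sym (⊔-assoc (a ⊓ b) (a ⊓ c) (b ⊓ c)) ⟩
    ((a ⊓ b) ⊔ (a ⊓ c)) ⊔ (b ⊓ c)       ≡⟨ cong (_⊔ (b ⊓ c)) (sym (⊓-distribˡ-⊔ a b c)) ⟩
    (a ⊓ (b ⊔ c)) ⊔ (b ⊓ c)             ∎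
  e₃ : (a ⊓ b) ⊓ c ≡ (a ⊓ (b ⊔ c)) ⊓ (b ⊓ c)
  e₃ = begin
    (a ⊓ b) ⊓ c             ≡⟨ ⊓-assoc a b c ⟩
    a ⊓ (b ⊓ c)             ≡⟨ cong (a ⊓_) (sym (resort-min b c)) ⟩
    a ⊓ ((b ⊔ c) ⊓ (b ⊓ c)) ≡⟨ sym (⊓-assoc a (b ⊔ c) (b ⊓ c)) ⟩
    (a ⊓ (b ⊔ c)) ⊓ (b ⊓ c) ∎
sortAt-braid zero    []          = refl
sortAt-braid zero    (a ∷ [])    = refl
sortAt-braid zero    (a ∷ b ∷ []) =
  cong₂ (λ u v → u ∷ v ∷ []) (resort-max a b) (resort-min a b)
sortAt-braid (suc k) []          = refl
sortAt-braid (suc k) (a ∷ l)     = cong (a ∷_) (sortAt-braid k l)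

commuting-idempotents-braid : (f g : List ℕ → List ℕ) → (∀ σ → g (f σ) ≡ f (g σ)) →
  (∀ σ → f (f σ) ≡ f σ) → (∀ σ → g (g σ) ≡ g σ) → ∀ π → f (g (f π)) ≡ g (f (g π))
commuting-idempotents-braid f g fg-comm f-idem g-idem π = begin
  f (g (f π)) ≡⟨ cong f (fg-comm π) ⟩
  f (f (g π)) ≡⟨ f-idem (g π) ⟩
  f (g π)     ≡⟨ cong f (sym (g-idem π)) ⟩
  f (g (g π)) ≡⟨ sym (fg-comm (g π)) ⟩
  g (f (g π)) ∎
  where open ≡-Reasoning

sortAt-braid-any : ∀ i j → i < j → ∀ π → sortAt i (sortAt j (sortAt i π)) ≡ sortAt j (sortAt i (sortAt j π))
sortAt-braid-any i j i<j π with m≤n⇒∃[o]m+o≡n i<j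
... | zero  , refl rewrite +-identityʳ i = sortAt-braid i π
... | suc d , refl rewrite +-suc i d =
  commuting-idempotents-braid (sortAt i) (sortAt (2 + i + d)) (sortAt-comm i d) (sortAt-idem i) (sortAt-idem _) π

demazure : List ℕ → List ℕ → List ℕ
demazure π u = foldl (λ σ i → sortAt (i ∸ 1) σ) π u

demazure-++ : ∀ π u v → demazure π (u ++ v) ≡ demazure (demazure π u) v
demazure-++ π u v = foldl-++ _ π u v

Positive : List ℕ → Set
Positive = All (1 ≤_)

demazure-respects-≈H : ∀ {u v} → u ≈H v → Positive u → ∀ π → demazure π u ≡ demazure π v
demazure-respects-≈H (idem u v i) _ π
  rewrite demazure-++ π u (i ∷ i ∷ v) | demazure-++ π u (i ∷ v) =
  cong (λ σ → demazure σ v) (sortAt-idem (i ∸ 1) (demazure π u))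
demazure-respects-≈H (braid u v i j) pos π with AllP.++⁻ u pos
... | _ , (s≤s _ ∷ s≤s _ ∷ _)
  rewrite demazure-++ π u (i ∷ j ∷ i ∷ v) | demazure-++ π u (j ∷ i ∷ j ∷ v) =
  cong (λ σ → demazure σ v) (braid₃ (i ∸ 1) (j ∸ 1) (demazure π u))
  where
  braid₃ : ∀ k l σ → sortAt k (sortAt l (sortAt k σ)) ≡ sortAt l (sortAt k (sortAt l σ))
  braid₃ k l σ with <-cmp k l
  ... | tri< k<l _ _ = sortAt-braid-any k l k<l σ
  ... | tri≈ _ refl _ = refl
  ... | tri> _ _ l<k = sym (sortAt-braid-any l k l<k σ)
demazure-respects-≈H (comm u v (suc i) (suc j) far) _ π
  rewrite demazure-++ π u (suc i ∷ suc j ∷ v) | demazure-++ π u (suc j ∷ suc i ∷ v) =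
  cong (λ σ → demazure σ v) (far₂ far (demazure π u))
  where
  far₂ : Far (suc i) (suc j) → ∀ σ → sortAt j (sortAt i σ) ≡ sortAt i (sortAt j σ)
  far₂ (inj₁ (s≤s le)) σ with m≤n⇒∃[o]m+o≡n le
  ... | d , refl = sortAt-comm i d σ
  far₂ (inj₂ (s≤s le)) σ with m≤n⇒∃[o]m+o≡n le
  ... | d , refl = sym (sortAt-comm j d σ)
demazure-respects-≈H (comm u v zero j _) pos π with AllP.++⁻ u pos
... | _ , (() ∷ _)
demazure-respects-≈H (comm u v (suc i) zero _) pos π with AllP.++⁻ u pos
... | _ , (_ ∷ () ∷ _)
demazure-respects-≈H (≈refl u) _ π = refl
demazure-respects-≈H (≈sym q) pos π = sym (demazure-respects-≈H q (≈H-reflects-All q pos) π)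
demazure-respects-≈H (≈trans q r) pos π =
  trans (demazure-respects-≈H q pos π) (demazure-respects-≈H r (≈H-preserves-All q pos) π)

-- (C) Inversion counts

T⇒≡true : ∀ {b} → T b → b ≡ true
T⇒≡true = Equivalence.to T-≡

≡true⇒T : ∀ {b} → b ≡ true → T b
≡true⇒T = Equivalence.from T-≡

<ᵇ-true : ∀ {m n} → m < n → (m <ᵇ n) ≡ true
<ᵇ-true m<n = T⇒≡true (<⇒<ᵇ m<n)

<ᵇ-false : ∀ {m n} → ¬ m < n → (m <ᵇ n) ≡ false
<ᵇ-false {m} {n} m≮n with m <ᵇ n in eq
... | true  = ⊥-elim (m≮n (<ᵇ⇒< m n (≡true⇒T eq)))
... | false = refl

countBelow : ℕ → List ℕ → ℕ
countBelow a []      = 0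
countBelow a (e ∷ l) = if e <ᵇ a then suc (countBelow a l) else countBelow a l

inversions : List ℕ → ℕ
inversions []      = 0
inversions (a ∷ l) = countBelow a l + inversions l

countBelow-swapAt : ∀ a k l → countBelow a (swapAt k l) ≡ countBelow a l
countBelow-swapAt a zero (x ∷ y ∷ l) with x <ᵇ a | y <ᵇ a
... | true  | true  = refl
... | true  | false = refl
... | false | true  = refl
... | false | false = refl
countBelow-swapAt a zero    []       = refl
countBelow-swapAt a zero    (x ∷ []) = refl
countBelow-swapAt a (suc k) []       = refl
countBelow-swapAt a (suc k) (x ∷ l) with x <ᵇ a
... | true  = cong suc (countBelow-swapAt a k l)
... | false = countBelow-swapAt a k l

+-exchange : ∀ a b c → a + (b + c) ≡ b + (a + c)
+-exchange a b c = trans (sym (+-assoc a b c)) (trans (cong (_+ c) (+-comm a b)) (+-assoc b a c))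

SortOrSwap : ℕ → List ℕ → Set
SortOrSwap k π =
  (sortAt k π ≡ swapAt k π × inversions (swapAt k π) ≡ suc (inversions π)) ⊎
  (sortAt k π ≡ π × inversions (swapAt k π) ≤ inversions π)

sortOrSwap : ∀ k π → SortOrSwap k π
sortOrSwap zero (x ∷ y ∷ l) with x <? y
... | yes x<y = inj₁ (cong₂ (λ u v → u ∷ v ∷ l) (m≤n⇒m⊔n≡n (<⇒≤ x<y)) (m≤n⇒m⊓n≡m (<⇒≤ x<y)) , one-more)
  where
  one-more : inversions (y ∷ x ∷ l) ≡ suc (inversions (x ∷ y ∷ l))
  one-more rewrite <ᵇ-true x<y | <ᵇ-false (<⇒≯ x<y) =
    cong suc (+-exchange (countBelow y l) (countBelow x l) (inversions l))
... | no x≮y = inj₂ (cong₂ (λ u v → u ∷ v ∷ l) (m≥n⇒m⊔n≡m (≮⇒≥ x≮y)) (m≥n⇒m⊓n≡n (≮⇒≥ x≮y)) , no-more)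
  where
  no-more : inversions (y ∷ x ∷ l) ≤ inversions (x ∷ y ∷ l)
  no-more rewrite <ᵇ-false x≮y with y <ᵇ x
  ... | true  = m≤n⇒m≤1+n (≤-reflexive (+-exchange (countBelow y l) (countBelow x l) (inversions l)))
  ... | false = ≤-reflexive (+-exchange (countBelow y l) (countBelow x l) (inversions l))
sortOrSwap zero    []       = inj₂ (refl , ≤-refl)
sortOrSwap zero    (x ∷ []) = inj₂ (refl , ≤-refl)
sortOrSwap (suc k) []       = inj₂ (refl , ≤-refl)
sortOrSwap (suc k) (a ∷ l) with sortOrSwap k l
... | inj₁ (sorted , more) =
  inj₁ (cong (a ∷_) sorted , trans (cong₂ _+_ (countBelow-swapAt a k l) more) (+-suc (countBelow a l) (inversions l)))
... | inj₂ (sorted , fewer) =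
  inj₂ (cong (a ∷_) sorted ,
        subst (λ z → z + inversions (swapAt k l) ≤ countBelow a l + inversions l)
              (sym (countBelow-swapAt a k l)) (+-monoʳ-≤ (countBelow a l) fewer))

permAct : List ℕ → List ℕ → List ℕ
permAct π u = foldl (λ σ i → swapAt (i ∸ 1) σ) π u

permAct-++ : ∀ π u v → permAct π (u ++ v) ≡ permAct (permAct π u) v
permAct-++ π u v = foldl-++ _ π u v

inversions-demazure : ∀ π u → inversions (demazure π u) ≤ inversions π + length u
inversions-demazure π [] = ≤-reflexive (sym (+-identityʳ _))
inversions-demazure π (i ∷ u) = ≤-trans (inversions-demazure (sortAt (i ∸ 1) π) u)
  (≤-trans (+-monoˡ-≤ (length u) sort-step) (≤-reflexive (sym (+-suc (inversions π) (length u)))))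
  where
  sort-step : inversions (sortAt (i ∸ 1) π) ≤ suc (inversions π)
  sort-step with sortOrSwap (i ∸ 1) π
  ... | inj₁ (sorted , more) rewrite sorted = ≤-reflexive more
  ... | inj₂ (sorted , _)    rewrite sorted = n≤1+n _

-- The same bound for the swap action; if it is attained then every letter met
-- an increasing pair, so the swap and Demazure actions of u coincide.
inversions-permAct : ∀ π u →
  inversions (permAct π u) ≤ inversions π + length u ×
  (inversions (permAct π u) ≡ inversions π + length u → permAct π u ≡ demazure π u)
inversions-permAct π [] = ≤-reflexive (sym (+-identityʳ _)) , λ _ → refl
inversions-permAct π (i ∷ u) with sortOrSwap (i ∸ 1) π | inversions-permAct (swapAt (i ∸ 1) π) u
... | inj₁ (sorted , more) | bound , tight =
  subst (inversions (permAct (swapAt (i ∸ 1) π) u) ≤_) shift bound ,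
  λ eq → trans (tight (trans eq (sym shift))) (cong (λ σ → demazure σ u) (sym sorted))
  where
  shift : inversions (swapAt (i ∸ 1) π) + length u ≡ inversions π + suc (length u)
  shift = trans (cong (_+ length u) more) (sym (+-suc (inversions π) (length u)))
... | inj₂ (_ , fewer) | bound , _ =
  ≤-trans strict (+-monoʳ-≤ (inversions π) (n≤1+n _)) ,
  λ eq → ⊥-elim (<-irrefl eq (≤-trans (s≤s strict) (≤-reflexive (sym (+-suc _ _)))))
  where
  strict : inversions (permAct (swapAt (i ∸ 1) π) u) ≤ inversions π + length u
  strict = ≤-trans bound (+-monoˡ-≤ (length u) fewer)

-- (D) The staircase tableau and its reading word

range : ℕ → ℕ → List ℕ
range m zero    = []
range m (suc n) = m ∷ range (suc m) n

descending : ℕ → List ℕ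
descending zero    = []
descending (suc n) = suc n ∷ descending n

-- triangle n = n(n+1)/2
triangle : ℕ → ℕ
triangle zero    = 0
triangle (suc n) = suc n + triangle n

staircaseTableau : ℕ → ℕ → Tableau
staircaseTableau m zero    = []
staircaseTableau m (suc n) = range m (suc n) ∷ staircaseTableau (suc m) n

readingWord : Tableau → List ℕ
readingWord []      = []
readingWord (R ∷ P) = readingWord P ++ R

length-range : ∀ m n → length (range m n) ≡ n
length-range m zero    = refl
length-range m (suc n) = cong suc (length-range (suc m) n)

range-bounds : ∀ m n → All (λ e → m ≤ e × e < m + n) (range m n)
range-bounds m zero    = []
range-bounds m (suc n) =
  (≤-refl , subst (_< m + suc n) (+-identityʳ m) (+-monoʳ-< m (s≤s z≤n))) ∷
  All.map (λ (lo , hi) → ≤-trans (n≤1+n m) lo , ≤-trans hi (≤-reflexive (sym (+-suc m n))))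
          (range-bounds (suc m) n)

identityPerm-range : ∀ q → identityPerm q ≡ range 1 (suc q)
identityPerm-range q = trans (map-upTo suc (suc q)) (applyUpTo-range 1 (suc q))
  where
  applyUpTo-range : ∀ k n → applyUpTo (k +_) n ≡ range k n
  applyUpTo-range k zero    = refl
  applyUpTo-range k (suc n) =
    cong₂ _∷_ (+-identityʳ k)
      (trans (applyUpTo-cong n (λ i → +-suc k i)) (applyUpTo-range (suc k) n))
    where
    applyUpTo-cong : ∀ n {f g : ℕ → ℕ} → (∀ i → f i ≡ g i) → applyUpTo f n ≡ applyUpTo g n
    applyUpTo-cong zero    eq = refl
    applyUpTo-cong (suc n) eq = cong₂ _∷_ (eq 0) (applyUpTo-cong n (λ i → eq (suc i)))

longestPerm-descending : ∀ q → longestPerm q ≡ descending (suc q)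
longestPerm-descending q = reverse-suc-upTo (suc q)
  where
  open ≡-Reasoning
  reverse-suc-upTo : ∀ n → reverse (map suc (upTo n)) ≡ descending n
  reverse-suc-upTo zero    = refl
  reverse-suc-upTo (suc n) = begin
    reverse (map suc (upTo (suc n)))        ≡⟨ cong (λ z → reverse (map suc z)) (sym (upTo-∷ʳ n)) ⟩
    reverse (map suc (upTo n ++ [ n ]))     ≡⟨ cong reverse (map-++ suc (upTo n) [ n ]) ⟩
    reverse (map suc (upTo n) ++ [ suc n ]) ≡⟨ reverse-++ (map suc (upTo n)) [ suc n ] ⟩
    suc n ∷ reverse (map suc (upTo n))      ≡⟨ cong (suc n ∷_) (reverse-suc-upTo n) ⟩
    descending (suc n)                      ∎

inversions-identityPerm : ∀ q → inversions (identityPerm q) ≡ 0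
inversions-identityPerm q = trans (cong inversions (identityPerm-range q)) (inversions-range 1 (suc q))
  where
  countBelow-none : ∀ a l → All (a ≤_) l → countBelow a l ≡ 0
  countBelow-none a []      []       = refl
  countBelow-none a (e ∷ l) (p ∷ ps) rewrite <ᵇ-false (≤⇒≯ p) = countBelow-none a l ps
  inversions-range : ∀ m n → inversions (range m n) ≡ 0
  inversions-range m zero    = refl
  inversions-range m (suc n) =
    cong₂ _+_ (countBelow-none m (range (suc m) n) (All.map (λ (lo , _) → <⇒≤ lo) (range-bounds (suc m) n)))
              (inversions-range (suc m) n)

inversions-longestPerm : ∀ q → inversions (longestPerm q) ≡ triangle q
inversions-longestPerm q = trans (cong inversions (longestPerm-descending q)) (inversions-descending q)
  where
  countBelow-all : ∀ a l → All (_< a) l → countBelow a l ≡ length l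
  countBelow-all a []      []       = refl
  countBelow-all a (e ∷ l) (p ∷ ps) rewrite <ᵇ-true p = cong suc (countBelow-all a l ps)
  descending-below : ∀ n → All (_< suc n) (descending n)
  descending-below zero    = []
  descending-below (suc n) = ≤-refl ∷ All.map m<n⇒m<1+n (descending-below n)
  length-descending : ∀ n → length (descending n) ≡ n
  length-descending zero    = refl
  length-descending (suc n) = cong suc (length-descending n)
  inversions-descending : ∀ n → inversions (descending (suc n)) ≡ triangle n
  inversions-descending zero    = refl
  inversions-descending (suc n) =
    cong₂ _+_ (trans (countBelow-all (suc (suc n)) (descending (suc n)) (descending-below (suc n)))
                     (length-descending (suc n)))
              (inversions-descending n)

swapAt-after : ∀ pre a b l → swapAt (length pre) (pre ++ a ∷ b ∷ l) ≡ pre ++ b ∷ a ∷ l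
swapAt-after []        a b l = refl
swapAt-after (c ∷ pre) a b l = cong (c ∷_) (swapAt-after pre a b l)

length-snoc : ∀ (pre : List ℕ) x → length (pre ++ [ x ]) ≡ suc (length pre)
length-snoc pre x = trans (length-++ pre) (+-comm (length pre) 1)

-- A bubble-sort pass: the letters of a row carry the entry x after pre to the end.
bubble : ∀ pre x Y → permAct (pre ++ x ∷ Y) (range (suc (length pre)) (length Y)) ≡ pre ++ Y ++ [ x ]
bubble pre x []      = refl
bubble pre x (y ∷ Y) = begin
  permAct (swapAt (length pre) (pre ++ x ∷ y ∷ Y)) (range (2 + length pre) (length Y))
    ≡⟨ cong (λ z → permAct z (range (2 + length pre) (length Y))) (swapAt-after pre x y Y) ⟩
  permAct (pre ++ y ∷ x ∷ Y) (range (2 + length pre) (length Y))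
    ≡⟨ cong₂ (λ z k → permAct z (range (suc k) (length Y))) (sym (++-assoc pre [ y ] (x ∷ Y))) (sym (length-snoc pre y)) ⟩
  permAct ((pre ++ [ y ]) ++ x ∷ Y) (range (suc (length (pre ++ [ y ]))) (length Y))
    ≡⟨ bubble (pre ++ [ y ]) x Y ⟩
  (pre ++ [ y ]) ++ Y ++ [ x ]
    ≡⟨ ++-assoc pre [ y ] (Y ++ [ x ]) ⟩
  pre ++ y ∷ Y ++ [ x ] ∎
  where open ≡-Reasoning

-- The reading word of the staircase reverses the block of n+1 entries after
-- pre: the lower rows reverse all but its first entry, the top row then
-- bubbles that entry to the end.
permAct-staircase : ∀ n pre X → length X ≡ suc n →
  permAct (pre ++ X) (readingWord (staircaseTableau (suc (length pre)) n)) ≡ pre ++ reverse X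
permAct-staircase zero    pre (x ∷ []) refl = refl
permAct-staircase (suc n) pre (x ∷ X) eq = begin
  permAct (pre ++ x ∷ X) (lower ++ top)          ≡⟨ permAct-++ (pre ++ x ∷ X) lower top ⟩
  permAct (permAct (pre ++ x ∷ X) lower) top     ≡⟨ cong (λ z → permAct z top) lower-reverses ⟩
  permAct (pre ++ x ∷ reverse X) top             ≡⟨ cong (λ k → permAct (pre ++ x ∷ reverse X) (range (suc (length pre)) k))
                                                         (sym length-reverse-X) ⟩
  permAct (pre ++ x ∷ reverse X) (range (suc (length pre)) (length (reverse X)))
                                                 ≡⟨ bubble pre x (reverse X) ⟩
  pre ++ reverse X ++ [ x ]                      ≡⟨ cong (pre ++_) (sym (unfold-reverse x X)) ⟩
  pre ++ reverse (x ∷ X)                         ∎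
  where
  open ≡-Reasoning
  lower = readingWord (staircaseTableau (2 + length pre) n)
  top   = range (suc (length pre)) (suc n)
  length-reverse-X : length (reverse X) ≡ suc n
  length-reverse-X = trans (length-reverse X) (suc-injective eq)
  lower-reverses : permAct (pre ++ x ∷ X) lower ≡ pre ++ x ∷ reverse X
  lower-reverses = begin
    permAct (pre ++ x ∷ X) lower
      ≡⟨ cong₂ (λ z k → permAct z (readingWord (staircaseTableau (suc k) n)))
               (sym (++-assoc pre [ x ] X)) (sym (length-snoc pre x)) ⟩
    permAct ((pre ++ [ x ]) ++ X) (readingWord (staircaseTableau (suc (length (pre ++ [ x ]))) n))
      ≡⟨ permAct-staircase n (pre ++ [ x ]) X (suc-injective eq) ⟩
    (pre ++ [ x ]) ++ reverse X ≡⟨ ++-assoc pre [ x ] (reverse X) ⟩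
    pre ++ x ∷ reverse X ∎

longestWord : ℕ → List ℕ
longestWord q = readingWord (staircaseTableau 1 q)

permOf-longestWord : ∀ q → permOf q (longestWord q) ≡ longestPerm q
permOf-longestWord q = permAct-staircase q [] (identityPerm q) length-identityPerm
  where
  length-identityPerm : length (identityPerm q) ≡ suc q
  length-identityPerm = trans (cong length (identityPerm-range q)) (length-range 1 (suc q))

length-longestWord : ∀ q → length (longestWord q) ≡ triangle q
length-longestWord q = length-staircase 1 q
  where
  length-staircase : ∀ m n → length (readingWord (staircaseTableau m n)) ≡ triangle n
  length-staircase m zero    = refl
  length-staircase m (suc n) =
    trans (length-++ (readingWord (staircaseTableau (suc m) n)))
      (trans (cong₂ _+_ (length-staircase (suc m) n) (length-range m (suc n))) (+-comm (triangle n) (suc n)))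

All-readingWord⁺ : ∀ {Q : ℕ → Set} P → All (All Q) P → All Q (readingWord P)
All-readingWord⁺ []      _         = []
All-readingWord⁺ (R ∷ P) (qR ∷ qP) = AllP.++⁺ (All-readingWord⁺ P qP) qR

All-readingWord⁻ : ∀ {Q : ℕ → Set} P → All Q (readingWord P) → All (All Q) P
All-readingWord⁻ []      _ = []
All-readingWord⁻ (R ∷ P) q with AllP.++⁻ (readingWord P) q
... | qP , qR = qR ∷ All-readingWord⁻ P qP

staircase-bounds : ∀ m n → All (All (λ e → m ≤ e × e < m + n)) (staircaseTableau m n)
staircase-bounds m zero    = []
staircase-bounds m (suc n) = range-bounds m (suc n) ∷
  All.map (All.map (λ (lo , hi) → ≤-trans (n≤1+n m) lo , ≤-trans hi (≤-reflexive (sym (+-suc m n)))))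
          (staircase-bounds (suc m) n)

longestWord-alphabet : ∀ q → InAlphabet q (longestWord q)
longestWord-alphabet q =
  All.map (λ (lo , hi) → lo , ≤-pred hi) (All-readingWord⁺ (staircaseTableau 1 q) (staircase-bounds 1 q))

-- Every word for w₀ has length at least its inversion number q(q+1)/2.
longestPerm-length : ∀ q v → permOf q v ≡ longestPerm q → triangle q ≤ length v
longestPerm-length q v v-w₀ =
  subst (_≤ length v) (trans (cong inversions v-w₀) (inversions-longestPerm q))
    (subst (λ z → inversions (permOf q v) ≤ z + length v) (inversions-identityPerm q)
      (proj₁ (inversions-permAct (identityPerm q) v)))

longestWord-reduced : ∀ q → Reduced q (longestWord q)
longestWord-reduced q = longestWord-alphabet q , shorter-differs
  where
  shorter-differs : ∀ v → InAlphabet q v → length v < length (longestWord q) → permOf q v ≢ permOf q (longestWord q)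
  shorter-differs v _ shorter v-w₀ = <⇒≱ shorter
    (subst (_≤ length v) (sym (length-longestWord q)) (longestPerm-length q v (trans v-w₀ (permOf-longestWord q))))

-- (E) Size of increasing tableaux with bounded entries

∧-split : ∀ {x y} → T (x ∧ y) → T x × T y
∧-split = Equivalence.to T-∧

∧-join : ∀ {x y} → T x → T y → T (x ∧ y)
∧-join p q = Equivalence.from T-∧ (p , q)

row-tail-above : ∀ a R → T (rowIncreasing (a ∷ R)) → All (a <_) R × T (rowIncreasing R)
row-tail-above a []      _ = [] , tt
row-tail-above a (b ∷ l) h with ∧-split {a <ᵇ b} h
... | a<b , rest with row-tail-above b l rest
... | b<l , _ = (<ᵇ⇒< a b a<b ∷ All.map (<-trans (<ᵇ⇒< a b a<b)) b<l) , rest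

cols-lower-bound : ∀ m R S → T (colsIncreasing R S) → All (m ≤_) R → All (suc m ≤_) S
cols-lower-bound m R       []      _ _        = []
cols-lower-bound m (a ∷ R) (b ∷ S) h (p ∷ ps) with ∧-split {a <ᵇ b} h
... | a<b , rest = ≤-trans (s≤s p) (<ᵇ⇒< a b a<b) ∷ cols-lower-bound m R S rest ps

row-length-bound : ∀ R m n → T (rowIncreasing R) → All (m ≤_) R → All (_< m + n) R → length R ≤ n
row-length-bound []      m n       _   _       _        = z≤n
row-length-bound (a ∷ R) m zero    _   (p ∷ _) (q ∷ _)  = ⊥-elim (<⇒≱ q (≤-trans (≤-reflexive (+-identityʳ m)) p))
row-length-bound (a ∷ R) m (suc n) inc (p ∷ _) (q ∷ qs) with row-tail-above a R inc
... | a<R , inc′ = s≤s (row-length-bound R (suc m) n inc′ (All.map (≤-trans (s≤s p)) a<R)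
                         (All.map (λ e< → ≤-trans e< (≤-reflexive (+-suc m n))) qs))

row-full : ∀ R m n → T (rowIncreasing R) → All (m ≤_) R → All (_< m + n) R → length R ≡ n → R ≡ range m n
row-full []      m zero    _   _        _        _  = refl
row-full (a ∷ R) m (suc n) inc (p ∷ ps) (q ∷ qs) eq with row-tail-above a R inc
... | a<R , inc′ = cong₂ _∷_ a≡m
        (row-full R (suc m) n inc′ (All.map (≤-trans (s≤s (≤-reflexive (sym a≡m)))) a<R) qs′ (suc-injective eq))
  where
  qs′ : All (_< suc m + n) R
  qs′ = All.map (λ e< → ≤-trans e< (≤-reflexive (+-suc m n))) qs
  a≡m : a ≡ m
  a≡m with m <? a
  ... | no m≮a  = ≤-antisym (≮⇒≥ m≮a) p
  ... | yes m<a = ⊥-elim (1+n≰n (subst (_≤ n) eq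
          (row-length-bound (a ∷ R) (suc m) n inc (m<a ∷ All.map (λ a< → ≤-trans m<a (<⇒≤ a<)) a<R)
                            (≤-trans q (≤-reflexive (+-suc m n)) ∷ qs′))))

FirstRowFrom : ℕ → Tableau → Set
FirstRowFrom m []      = ⊤
FirstRowFrom m (R ∷ _) = All (m ≤_) R

size : Tableau → ℕ
size P = sum (map length P)

increasing-uncons : ∀ R T′ → T (isIncreasing (R ∷ T′)) →
  T (nonEmpty R) × T (rowIncreasing R) × T (isIncreasing T′) × (∀ m → All (m ≤_) R → FirstRowFrom (suc m) T′)
increasing-uncons R [] h with ∧-split {nonEmpty R} h
... | ne , inc = ne , inc , tt , λ _ _ → tt
increasing-uncons R (S ∷ T′) h with ∧-split {nonEmpty R} h
... | ne , h₁ with ∧-split {rowIncreasing R} h₁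
... | inc , h₂ with ∧-split {colsIncreasing R S} h₂
... | cols , rest = ne , inc , rest , λ m p → cols-lower-bound m R S cols p

squeeze : ∀ {a b c d} → a ≤ c → b ≤ d → c + d ≤ a + b → a ≡ c × d ≤ b
squeeze {a} {b} {c} {d} a≤c b≤d sum≤ with m≤n⇒m<n∨m≡n a≤c
... | inj₂ a≡c = a≡c , +-cancelˡ-≤ c d b (subst (λ z → c + d ≤ z + b) a≡c sum≤)
... | inj₁ a<c = ⊥-elim (<⇒≱ (+-monoˡ-< b a<c) (≤-trans (+-monoʳ-≤ c b≤d) sum≤))

-- An increasing tableau with entries in [m, m+n) has at most n(n+1)/2 boxes,
-- and exactly that many only if it is the staircase: row i has at most n-i
-- boxes, since its entries are at least m+i.
increasing-tableau-size : ∀ P m n → T (isIncreasing P) → FirstRowFrom m P → All (All (_< m + n)) P →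
  size P ≤ triangle n × (triangle n ≤ size P → P ≡ staircaseTableau m n)
increasing-tableau-size [] m zero    _ _ _ = z≤n , λ _ → refl
increasing-tableau-size [] m (suc n) _ _ _ = z≤n , λ ()
increasing-tableau-size (R ∷ T′) m n inc first (R< ∷ T′<) with increasing-uncons R T′ inc
increasing-tableau-size ([] ∷ T′) m n inc first (R< ∷ T′<) | () , _
increasing-tableau-size ((a ∷ _) ∷ T′) m zero inc (m≤a ∷ _) ((a< ∷ _) ∷ _) | _ =
  ⊥-elim (<⇒≱ a< (≤-trans (≤-reflexive (+-identityʳ m)) m≤a))
increasing-tableau-size (R@(_ ∷ _) ∷ T′) m (suc n) inc first (R< ∷ T′<) | _ , incR , incT′ , next =
  +-mono-≤ length-R (proj₁ rest) ,
  λ full → let (R-full , rest-full) = squeeze length-R (proj₁ rest) full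
           in cong₂ _∷_ (row-full R m (suc n) incR first R< R-full) (proj₂ rest rest-full)
  where
  length-R : length R ≤ suc n
  length-R = row-length-bound R m (suc n) incR first R<
  rest = increasing-tableau-size T′ (suc m) n incT′ (next m first)
           (All.map (All.map (λ e< → ≤-trans e< (≤-reflexive (+-suc m n)))) T′<)

-- (F) Hecke insertion preserves the reading word up to ≈H
--
-- Insertion is followed row by row.  With the current row R, the rows B below
-- it and the rows Above above it, we track up to ≈H the reading word with the
-- pending letter x placed right after R; each row step either ends the
-- insertion or passes a bumped letter to the front of the next row, by the
-- word identities below.  Changes breaking increasingness are rejected by the
-- algorithm; the invariant BumpBound shows this happens only when x meets an
-- equal letter, which idempotence then absorbs.

false-not-T : ∀ {b} → b ≡ false → ¬ T b
false-not-T refl ()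

row-join : ∀ R₁ z R₂ → T (rowIncreasing R₁) → All (_< z) R₁ → T (rowIncreasing (z ∷ R₂)) →
  T (rowIncreasing (R₁ ++ z ∷ R₂))
row-join []           z R₂ _   _        inc = inc
row-join (a ∷ [])     z R₂ _   (a<z ∷ []) inc = ∧-join (<⇒<ᵇ a<z) inc
row-join (a ∷ b ∷ R₁) z R₂ inc₁ (_ ∷ <z) inc with ∧-split {a <ᵇ b} inc₁
... | a<b , rest = ∧-join a<b (row-join (b ∷ R₁) z R₂ rest <z inc)

row-suffix : ∀ R₁ R₂ → T (rowIncreasing (R₁ ++ R₂)) → T (rowIncreasing R₂)
row-suffix []           R₂       inc = inc
row-suffix (a ∷ [])     []       inc = tt
row-suffix (a ∷ [])     (b ∷ R₂) inc = proj₂ (∧-split {a <ᵇ b} inc)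
row-suffix (a ∷ b ∷ R₁) R₂       inc = row-suffix (b ∷ R₁) R₂ (proj₂ (∧-split {a <ᵇ b} inc))

row-prefix : ∀ R₁ R₂ → T (rowIncreasing (R₁ ++ R₂)) → T (rowIncreasing R₁)
row-prefix []           R₂ inc = tt
row-prefix (a ∷ [])     R₂ inc = tt
row-prefix (a ∷ b ∷ R₁) R₂ inc =
  ∧-join (proj₁ (∧-split {a <ᵇ b} inc)) (row-prefix (b ∷ R₁) R₂ (proj₂ (∧-split {a <ᵇ b} inc)))

row-lower-head : ∀ y x R → x ≤ y → T (rowIncreasing (y ∷ R)) → T (rowIncreasing (x ∷ R))
row-lower-head y x []      _   _   = tt
row-lower-head y x (b ∷ R) x≤y inc with ∧-split {y <ᵇ b} inc
... | y<b , rest = ∧-join (<⇒<ᵇ (≤-<-trans x≤y (<ᵇ⇒< y b y<b))) rest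

row-no-repeat : ∀ R₁ x R₂ → ¬ T (rowIncreasing (R₁ ++ x ∷ x ∷ R₂))
row-no-repeat R₁ x R₂ inc =
  <-irrefl refl (<ᵇ⇒< x x (proj₁ (∧-split {x <ᵇ x} (row-suffix R₁ (x ∷ x ∷ R₂) inc))))

nonEmpty-middle : ∀ R₁ x R₂ → T (nonEmpty (R₁ ++ x ∷ R₂))
nonEmpty-middle []      x R₂ = tt
nonEmpty-middle (a ∷ _) x R₂ = tt

RowSplit : ℕ → List ℕ → Set
RowSplit x R = All (_< x) R ⊎
  (∃ λ R₁ → ∃ λ y → ∃ λ R₂ → R ≡ R₁ ++ y ∷ R₂ × All (_< x) R₁ × x ≤ y × All (y <_) R₂)

rowSplit : ∀ x R → T (rowIncreasing R) → RowSplit x R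
rowSplit x []      _   = inj₁ []
rowSplit x (a ∷ R) inc with a <? x | row-tail-above a R inc
... | no  a≮x | a<R , _ = inj₂ ([] , a , R , refl , [] , ≮⇒≥ a≮x , a<R)
... | yes a<x | _ , inc′ with rowSplit x R inc′
...   | inj₁ R<x = inj₁ (a<x ∷ R<x)
...   | inj₂ (R₁ , y , R₂ , refl , R₁<x , x≤y , y<R₂) = inj₂ (a ∷ R₁ , y , R₂ , refl , a<x ∷ R₁<x , x≤y , y<R₂)

cols-split : ∀ A₁ A₂ B₁ B₂ → length A₁ ≡ length B₁ → T (colsIncreasing (A₁ ++ A₂) (B₁ ++ B₂)) →
  T (colsIncreasing A₁ B₁) × T (colsIncreasing A₂ B₂)
cols-split []       A₂ []       B₂ _  cols = tt , cols
cols-split (a ∷ A₁) A₂ (b ∷ B₁) B₂ eq cols with ∧-split {a <ᵇ b} cols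
... | a<b , rest with cols-split A₁ A₂ B₁ B₂ (suc-injective eq) rest
... | cols₁ , cols₂ = ∧-join a<b cols₁ , cols₂

cols-join : ∀ A₁ A₂ B₁ B₂ → length A₁ ≡ length B₁ → T (colsIncreasing A₁ B₁) → T (colsIncreasing A₂ B₂) →
  T (colsIncreasing (A₁ ++ A₂) (B₁ ++ B₂))
cols-join []       A₂ []       B₂ _  _     cols₂ = cols₂
cols-join (a ∷ A₁) A₂ (b ∷ B₁) B₂ eq cols₁ cols₂ with ∧-split {a <ᵇ b} cols₁
... | a<b , rest = ∧-join a<b (cols-join A₁ A₂ B₁ B₂ (suc-injective eq) rest cols₂)

cols-extend : ∀ A C B → T (colsIncreasing A B) → T (colsIncreasing (A ++ C) B)
cols-extend A       C []      _    = tt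
cols-extend (a ∷ A) C (b ∷ B) cols with ∧-split {a <ᵇ b} cols
... | a<b , rest = ∧-join a<b (cols-extend A C B rest)

cols-lower-at : ∀ A₁ a a′ A₂ S → a′ ≤ a → T (colsIncreasing (A₁ ++ a ∷ A₂) S) → T (colsIncreasing (A₁ ++ a′ ∷ A₂) S)
cols-lower-at []       a a′ A₂ []      _     _    = tt
cols-lower-at []       a a′ A₂ (s ∷ S) a′≤a cols with ∧-split {a <ᵇ s} cols
... | a<s , rest = ∧-join (<⇒<ᵇ (≤-<-trans a′≤a (<ᵇ⇒< a s a<s))) rest
cols-lower-at (b ∷ A₁) a a′ A₂ []      _     _    = tt
cols-lower-at (b ∷ A₁) a a′ A₂ (s ∷ S) a′≤a cols with ∧-split {b <ᵇ s} cols
... | b<s , rest = ∧-join b<s (cols-lower-at A₁ a a′ A₂ S a′≤a rest)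

cols-far : ∀ x A B → length A ≡ length B → T (colsIncreasing A B) → All (_< x) B → All (Far x) A
cols-far x []      []      _  _    _          = []
cols-far x (a ∷ A) (b ∷ B) eq cols (b<x ∷ B<x) with ∧-split {a <ᵇ b} cols
... | a<b , rest = inj₂ (≤-trans (s≤s (<ᵇ⇒< a b a<b)) b<x) ∷ cols-far x A B (suc-injective eq) rest B<x

far-below : ∀ {x y} R → All (_< x) R → x < y → All (Far y) R
far-below R R<x x<y = All.map (λ e<x → inj₂ (≤-trans (s≤s e<x) x<y)) R<x

far-above : ∀ {x y} R → x < y → All (y <_) R → All (Far x) R
far-above R x<y y<R = All.map (λ y<e → inj₁ (≤-trans (s≤s x<y) y<e)) y<R

split-at-index : ∀ (L : List ℕ) k → k < length L →
  ∃ λ L₁ → ∃ λ a → ∃ λ L₂ → L ≡ L₁ ++ a ∷ L₂ × length L₁ ≡ k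
split-at-index (a ∷ L) zero    _       = [] , a , L , refl , refl
split-at-index (a ∷ L) (suc k) (s≤s k<) with split-at-index L k k<
... | L₁ , b , L₂ , refl , refl = a ∷ L₁ , b , L₂ , refl , refl

All-middle : ∀ {P : ℕ → Set} L₁ a L₂ → All P (L₁ ++ a ∷ L₂) → P a
All-middle L₁ a L₂ all with AllP.++⁻ L₁ all
... | _ , (pa ∷ _) = pa

allLeq-holds : ∀ x R → All (_≤ x) R → allLeq x R ≡ true
allLeq-holds x []      []         = refl
allLeq-holds x (e ∷ R) (e≤x ∷ R≤x) rewrite T⇒≡true (≤⇒≤ᵇ e≤x) = allLeq-holds x R R≤x

allLeq-fails : ∀ x R₁ y R₂ → x < y → allLeq x (R₁ ++ y ∷ R₂) ≡ false
allLeq-fails x []       y R₂ x<y with y ≤ᵇ x in y≤x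
... | true  = ⊥-elim (<⇒≱ x<y (≤ᵇ⇒≤ y x (≡true⇒T y≤x)))
... | false = refl
allLeq-fails x (a ∷ R₁) y R₂ x<y with a ≤ᵇ x
... | true  = allLeq-fails x R₁ y R₂ x<y
... | false = refl

smallestAbove-is : ∀ x R₁ y R₂ → All (_≤ x) R₁ → x < y → All (y <_) R₂ → smallestAbove x (R₁ ++ y ∷ R₂) ≡ y
smallestAbove-is x R₁ y R₂ R₁≤x x<y y<R₂ = trans (via-filter {R₁ ++ y ∷ R₂} filtered) (minimumWith-least y R₂ y<R₂)
  where
  via-filter : ∀ {R a l} → filter (λ e → T? (x <ᵇ e)) R ≡ a ∷ l → smallestAbove x R ≡ minimumWith a l
  via-filter eq rewrite eq = refl
  filtered : filter (λ e → T? (x <ᵇ e)) (R₁ ++ y ∷ R₂) ≡ y ∷ R₂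
  filtered = trans (filter-++ (λ e → T? (x <ᵇ e)) R₁ (y ∷ R₂))
    (cong₂ _++_ (filter-none (λ e → T? (x <ᵇ e)) (All.map (λ e≤x x<e → ≤⇒≯ e≤x (<ᵇ⇒< x _ x<e)) R₁≤x))
                (filter-all (λ e → T? (x <ᵇ e)) (<⇒<ᵇ x<y ∷ All.map (λ y<e → <⇒<ᵇ (<-trans x<y y<e)) y<R₂)))
  minimumWith-least : ∀ y l → All (y <_) l → minimumWith y l ≡ y
  minimumWith-least y []      []           = refl
  minimumWith-least y (a ∷ l) (y<a ∷ y<l) rewrite <ᵇ-false (<⇒≯ y<a) = minimumWith-least y l y<l

replaceBy : ℕ → ℕ → ℕ → ℕ
replaceBy x y e = if e ≡ᵇ y then x else e

map-replaceBy : ∀ x y R₁ R₂ → All (_< y) R₁ → All (y <_) R₂ → map (replaceBy x y) (R₁ ++ y ∷ R₂) ≡ R₁ ++ x ∷ R₂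
map-replaceBy x y R₁ R₂ R₁<y y<R₂ = trans (map-++ (replaceBy x y) R₁ (y ∷ R₂))
  (cong₂ _++_ (map-id-local (All.map (λ e<y → replace-other (<⇒≢ e<y)) R₁<y))
              (cong₂ _∷_ replace-same (map-id-local (All.map (λ y<e → replace-other (≢-sym (<⇒≢ y<e))) y<R₂))))
  where
  replace-other : ∀ {e} → e ≢ y → replaceBy x y e ≡ e
  replace-other {e} e≢y with e ≡ᵇ y in eq
  ... | true  = ⊥-elim (e≢y (≡ᵇ⇒≡ e y (≡true⇒T eq)))
  ... | false = refl
  replace-same : replaceBy x y y ≡ x
  replace-same rewrite T⇒≡true (≡⇒≡ᵇ y y refl) = refl

-- A tableau viewed from a current row: stack Above X places the rows Above
-- (nearest first) on top of X, and readAbove Above is their part of the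
-- reading word.
stack : Tableau → Tableau → Tableau
stack []          X = X
stack (P ∷ Above) X = stack Above (P ∷ X)

readAbove : Tableau → List ℕ
readAbove []          = []
readAbove (P ∷ Above) = P ++ readAbove Above

readingWord-stack : ∀ Above X → readingWord (stack Above X) ≡ readingWord X ++ readAbove Above
readingWord-stack []          X = sym (++-identityʳ (readingWord X))
readingWord-stack (P ∷ Above) X =
  trans (readingWord-stack Above (P ∷ X)) (++-assoc (readingWord X) P (readAbove Above))

getRow-current : ∀ Above X → getRow (length Above) (stack Above X) ≡ getRow 0 X
getRow-current Above X =
  subst (λ k → getRow k (stack Above X) ≡ getRow 0 X) (+-identityʳ (length Above)) (shifted Above 0 X)
  where
  shifted : ∀ Above k X → getRow (length Above + k) (stack Above X) ≡ getRow k X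
  shifted []          k X = refl
  shifted (P ∷ Above) k X rewrite sym (+-suc (length Above) k) = shifted Above (suc k) (P ∷ X)

setRow-current : ∀ Above R X → setRow (length Above) R (stack Above X) ≡ stack Above (setRow 0 R X)
setRow-current Above R X =
  subst (λ k → setRow k R (stack Above X) ≡ stack Above (setRow 0 R X)) (+-identityʳ (length Above)) (shifted Above 0 X)
  where
  shifted : ∀ Above k X → setRow (length Above + k) R (stack Above X) ≡ stack Above (setRow k R X)
  shifted []          k X = refl
  shifted (P ∷ Above) k X rewrite sym (+-suc (length Above) k) = shifted Above (suc k) (P ∷ X)

FitsAbove : Tableau → List ℕ → Bool
FitsAbove []          P = true
FitsAbove (Q ∷ Above) P = FitsAbove Above Q ∧ (nonEmpty Q ∧ rowIncreasing Q ∧ colsIncreasing Q P)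

∧-reassoc : ∀ a b c d e → a ∧ (b ∧ (c ∧ (d ∧ e))) ≡ (a ∧ (b ∧ (c ∧ d))) ∧ e
∧-reassoc true  true  true  true  e = refl
∧-reassoc true  true  true  false e = refl
∧-reassoc true  true  false d     e = refl
∧-reassoc true  false c     d     e = refl
∧-reassoc false b     c     d     e = refl

isIncreasing-stack : ∀ Above P Y → isIncreasing (stack Above (P ∷ Y)) ≡ FitsAbove Above P ∧ isIncreasing (P ∷ Y)
isIncreasing-stack []          P Y       = refl
isIncreasing-stack (Q ∷ Above) P []      = trans (isIncreasing-stack Above Q (P ∷ []))
  (∧-reassoc (FitsAbove Above Q) (nonEmpty Q) (rowIncreasing Q) (colsIncreasing Q P) _)
isIncreasing-stack (Q ∷ Above) P (S ∷ Y) = trans (isIncreasing-stack Above Q (P ∷ S ∷ Y))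
  (∧-reassoc (FitsAbove Above Q) (nonEmpty Q) (rowIncreasing Q) (colsIncreasing Q P) _)

isIncreasing-stack⁻ : ∀ Above P Y → T (isIncreasing (stack Above (P ∷ Y))) →
  T (FitsAbove Above P) × T (isIncreasing (P ∷ Y))
isIncreasing-stack⁻ Above P Y inc = ∧-split (subst T (isIncreasing-stack Above P Y) inc)

isIncreasing-stack⁺ : ∀ Above P Y → T (FitsAbove Above P) → T (isIncreasing (P ∷ Y)) →
  T (isIncreasing (stack Above (P ∷ Y)))
isIncreasing-stack⁺ Above P Y fits inc = subst T (sym (isIncreasing-stack Above P Y)) (∧-join fits inc)

CompatibleAbove : Tableau → List ℕ → Set
CompatibleAbove []      R = ⊤
CompatibleAbove (P ∷ _) R = T (colsIncreasing P R)

CompatibleBelow : List ℕ → Tableau → Set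
CompatibleBelow R []      = ⊤
CompatibleBelow R (S ∷ _) = T (colsIncreasing R S)

fitsAbove-compatible : ∀ Above R → T (FitsAbove Above R) → CompatibleAbove Above R
fitsAbove-compatible []          R _    = tt
fitsAbove-compatible (Q ∷ Above) R fits with ∧-split {FitsAbove Above Q} fits
... | _ , rest with ∧-split {nonEmpty Q} rest
... | _ , rest′ = proj₂ (∧-split {rowIncreasing Q} rest′)

fitsAbove-replace : ∀ Above R R′ → T (FitsAbove Above R) → CompatibleAbove Above R′ → T (FitsAbove Above R′)
fitsAbove-replace []          R R′ _    _      = tt
fitsAbove-replace (Q ∷ Above) R R′ fits compat with ∧-split {FitsAbove Above Q} fits
... | fitsQ , rest with ∧-split {nonEmpty Q} rest
... | neQ , rest′ = ∧-join fitsQ (∧-join neQ (∧-join (proj₁ (∧-split {rowIncreasing Q} rest′)) compat))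

current-row-facts : ∀ Above R B → T (isIncreasing (stack Above (R ∷ B))) →
  T (nonEmpty R) × T (rowIncreasing R) × CompatibleAbove Above R × CompatibleBelow R B
current-row-facts Above R B inc with isIncreasing-stack⁻ Above R B inc
current-row-facts Above R []      inc | fits , incR with ∧-split {nonEmpty R} incR
... | ne , rowR = ne , rowR , fitsAbove-compatible Above R fits , tt
current-row-facts Above R (S ∷ B) inc | fits , incR with ∧-split {nonEmpty R} incR
... | ne , rest with ∧-split {rowIncreasing R} rest
... | rowR , rest′ = ne , rowR , fitsAbove-compatible Above R fits , proj₁ (∧-split {colsIncreasing R S} rest′)

replace-current-row : ∀ Above R R′ B → T (isIncreasing (stack Above (R ∷ B))) →
  T (nonEmpty R′) → T (rowIncreasing R′) → CompatibleAbove Above R′ → CompatibleBelow R′ B →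
  T (isIncreasing (stack Above (R′ ∷ B)))
replace-current-row Above R R′ B inc ne rowR′ above below with isIncreasing-stack⁻ Above R B inc
replace-current-row Above R R′ []      inc ne rowR′ above below | fits , _ =
  isIncreasing-stack⁺ Above R′ [] (fitsAbove-replace Above R R′ fits above) (∧-join ne rowR′)
replace-current-row Above R R′ (S ∷ B) inc ne rowR′ above below | fits , incR with ∧-split {nonEmpty R} incR
... | _ , rest with ∧-split {rowIncreasing R} rest
... | _ , rest′ = isIncreasing-stack⁺ Above R′ (S ∷ B) (fitsAbove-replace Above R R′ fits above)
                    (∧-join ne (∧-join rowR′ (∧-join below (proj₂ (∧-split {colsIncreasing R S} rest′)))))

add-singleton-row : ∀ Above P x → T (isIncreasing (stack (P ∷ Above) [])) → T (colsIncreasing P (x ∷ [])) →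
  T (isIncreasing (stack (P ∷ Above) ((x ∷ []) ∷ [])))
add-singleton-row Above P x inc cols with isIncreasing-stack⁻ Above P [] inc
... | fits , incP with ∧-split {nonEmpty P} incP
... | ne , rowP = isIncreasing-stack⁺ Above P ((x ∷ []) ∷ []) fits (∧-join ne (∧-join rowP (∧-join cols tt)))

firstRow : Tableau → List ℕ
firstRow []      = []
firstRow (S ∷ _) = S

compatibleBelow-firstRow : ∀ R B → CompatibleBelow R B → T (colsIncreasing R (firstRow B))
compatibleBelow-firstRow R []      _      = tt
compatibleBelow-firstRow R (S ∷ B) compat = compat

compatibleBelow-extend : ∀ R C B → CompatibleBelow R B → CompatibleBelow (R ++ C) B
compatibleBelow-extend R C []      _      = tt
compatibleBelow-extend R C (S ∷ B) compat = cols-extend R C S compat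

compatibleBelow-lower : ∀ R₁ y x R₂ B → x ≤ y → CompatibleBelow (R₁ ++ y ∷ R₂) B → CompatibleBelow (R₁ ++ x ∷ R₂) B
compatibleBelow-lower R₁ y x R₂ []      _   _      = tt
compatibleBelow-lower R₁ y x R₂ (S ∷ B) x≤y compat = cols-lower-at R₁ y x R₂ S x≤y compat

keepIfIncreasing-cases : ∀ P P′ (Goal : Tableau → Set) →
  (T (isIncreasing P′) → Goal P′) → (isIncreasing P′ ≡ false → Goal P) → Goal (keepIfIncreasing P P′)
keepIfIncreasing-cases P P′ Goal kept rejected with isIncreasing P′ in inc
... | true  = kept tt
... | false = rejected refl

-- y is bumped by x < y: the pending x moves into y's place, y moves in front.
bump-word : ∀ R₁ y R₂ x Z → All (Far y) R₁ → All (Far x) R₂ →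
  ((R₁ ++ y ∷ R₂) ++ x ∷ Z) ≈H (y ∷ (R₁ ++ x ∷ R₂) ++ Z)
bump-word R₁ y R₂ x Z y-far x-far =
  (R₁ ++ y ∷ R₂) ++ x ∷ Z      ≡≈⟨ trans (++-assoc R₁ (y ∷ R₂) (x ∷ Z)) (sym (++-assoc R₁ [ y ] (R₂ ++ x ∷ Z))) ⟩
  (R₁ ++ [ y ]) ++ R₂ ++ x ∷ Z ≈⟨ ≈sym (commute-past (R₁ ++ [ y ]) x R₂ Z x-far) ⟩
  (R₁ ++ [ y ]) ++ x ∷ R₂ ++ Z ≡≈⟨ ++-assoc R₁ [ y ] (x ∷ R₂ ++ Z) ⟩
  R₁ ++ y ∷ (x ∷ R₂ ++ Z)      ≈⟨ ≈sym (commute-past [] y R₁ (x ∷ R₂ ++ Z) y-far) ⟩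
  y ∷ R₁ ++ x ∷ R₂ ++ Z        ≡≈⟨ cong (y ∷_) (sym (++-assoc R₁ (x ∷ R₂) Z)) ⟩
  y ∷ (R₁ ++ x ∷ R₂) ++ Z      ≈∎

-- x already occurs, followed by y: the braid x y x = y x y moves y in front.
bump-word-braid : ∀ R₁ x y R₂ Z → All (Far y) R₁ → All (Far x) R₂ →
  ((R₁ ++ x ∷ y ∷ R₂) ++ x ∷ Z) ≈H (y ∷ (R₁ ++ x ∷ y ∷ R₂) ++ Z)
bump-word-braid R₁ x y R₂ Z y-far x-far =
  (R₁ ++ x ∷ y ∷ R₂) ++ x ∷ Z       ≡≈⟨ trans (++-assoc R₁ (x ∷ y ∷ R₂) (x ∷ Z))
                                              (sym (++-assoc R₁ (x ∷ y ∷ []) (R₂ ++ x ∷ Z))) ⟩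
  (R₁ ++ x ∷ y ∷ []) ++ R₂ ++ x ∷ Z ≈⟨ ≈sym (commute-past (R₁ ++ x ∷ y ∷ []) x R₂ Z x-far) ⟩
  (R₁ ++ x ∷ y ∷ []) ++ x ∷ R₂ ++ Z ≡≈⟨ ++-assoc R₁ (x ∷ y ∷ []) (x ∷ R₂ ++ Z) ⟩
  R₁ ++ x ∷ y ∷ x ∷ (R₂ ++ Z)       ≈⟨ braid R₁ (R₂ ++ Z) x y ⟩
  R₁ ++ y ∷ (x ∷ y ∷ R₂ ++ Z)       ≈⟨ ≈sym (commute-past [] y R₁ (x ∷ y ∷ R₂ ++ Z) y-far) ⟩
  y ∷ R₁ ++ x ∷ y ∷ R₂ ++ Z         ≡≈⟨ cong (y ∷_) (sym (++-assoc R₁ (x ∷ y ∷ R₂) Z)) ⟩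
  y ∷ (R₁ ++ x ∷ y ∷ R₂) ++ Z       ≈∎

-- x is absorbed by an equal entry of the row above, reached past far letters.
absorb-above : ∀ R x Q₁ Q₂ Z → All (Far x) Q₁ → (R ++ x ∷ (Q₁ ++ x ∷ Q₂) ++ Z) ≈H (R ++ (Q₁ ++ x ∷ Q₂) ++ Z)
absorb-above R x Q₁ Q₂ Z x-far =
  R ++ x ∷ (Q₁ ++ x ∷ Q₂) ++ Z   ≡≈⟨ cong (λ v → R ++ x ∷ v) (++-assoc Q₁ (x ∷ Q₂) Z) ⟩
  R ++ x ∷ Q₁ ++ (x ∷ Q₂ ++ Z)   ≈⟨ commute-past R x Q₁ (x ∷ Q₂ ++ Z) x-far ⟩
  R ++ Q₁ ++ x ∷ x ∷ Q₂ ++ Z     ≡≈⟨ sym (++-assoc R Q₁ (x ∷ x ∷ Q₂ ++ Z)) ⟩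
  (R ++ Q₁) ++ x ∷ x ∷ (Q₂ ++ Z) ≈⟨ idem (R ++ Q₁) (Q₂ ++ Z) x ⟩
  (R ++ Q₁) ++ x ∷ (Q₂ ++ Z)     ≡≈⟨ trans (++-assoc R Q₁ (x ∷ Q₂ ++ Z))
                                          (cong (R ++_) (sym (++-assoc Q₁ (x ∷ Q₂) Z))) ⟩
  R ++ (Q₁ ++ x ∷ Q₂) ++ Z       ≈∎

absorb-adjacent : ∀ R₁ x Z → ((R₁ ++ x ∷ []) ++ x ∷ Z) ≈H ((R₁ ++ x ∷ []) ++ Z)
absorb-adjacent R₁ x Z =
  (R₁ ++ x ∷ []) ++ x ∷ Z ≡≈⟨ ++-assoc R₁ (x ∷ []) (x ∷ Z) ⟩
  R₁ ++ x ∷ x ∷ Z         ≈⟨ idem R₁ Z x ⟩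
  R₁ ++ x ∷ Z             ≡≈⟨ sym (++-assoc R₁ (x ∷ []) Z) ⟩
  (R₁ ++ x ∷ []) ++ Z     ≈∎

duplicate-front : ∀ R₁ y R₂ Z → All (Far y) R₁ → ((R₁ ++ y ∷ R₂) ++ Z) ≈H (y ∷ (R₁ ++ y ∷ R₂) ++ Z)
duplicate-front R₁ y R₂ Z y-far = ≈sym (
  y ∷ (R₁ ++ y ∷ R₂) ++ Z ≡≈⟨ cong (y ∷_) (++-assoc R₁ (y ∷ R₂) Z) ⟩
  y ∷ R₁ ++ y ∷ (R₂ ++ Z) ≈⟨ commute-past [] y R₁ (y ∷ R₂ ++ Z) y-far ⟩
  R₁ ++ y ∷ y ∷ (R₂ ++ Z) ≈⟨ idem R₁ (R₂ ++ Z) y ⟩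
  R₁ ++ y ∷ (R₂ ++ Z)     ≡≈⟨ sym (++-assoc R₁ (y ∷ R₂) Z) ⟩
  (R₁ ++ y ∷ R₂) ++ Z     ≈∎)

-- The invariant of the bumping path: over every position of R at which the
-- letter x may be placed (after a prefix of entries below x), the row P just
-- above R has an entry q ≤ x.  When a change is rejected this forces q = x.
BumpBound : List ℕ → List ℕ → ℕ → Set
BumpBound P R x = ∀ R₁ R₂ → R ≡ R₁ ++ R₂ → All (_< x) R₁ →
  ∃ λ P₁ → ∃ λ q → ∃ λ P₂ → P ≡ P₁ ++ q ∷ P₂ × length P₁ ≡ length R₁ × q ≤ x

BumpBoundAbove : Tableau → List ℕ → ℕ → Set
BumpBoundAbove []      R x = ⊤
BumpBoundAbove (P ∷ _) R x = BumpBound P R x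

-- y leaves position |R₁| of a row whose old version R₁ y R₂′ sat correctly on
-- S; the new row R₁ z R₂ (z ≤ y) then bounds y over S: a prefix of S below y
-- cannot reach column |R₁|, where S exceeds y, so it ends under R₁ z ≤ y.
bumpBound-next : ∀ R₁ z R₂ R₂′ S y → All (_< y) R₁ → z ≤ y → T (colsIncreasing (R₁ ++ y ∷ R₂′) S) →
  BumpBound (R₁ ++ z ∷ R₂) S y
bumpBound-next R₁ z R₂ R₂′ S y R₁<y z≤y cols S₁ S₂ refl S₁<y with length R₁ <? length S₁
... | yes R₁-shorter with split-at-index S₁ (length R₁) R₁-shorter
...   | S₁ᵃ , s , S₁ᵇ , refl , same-length = ⊥-elim (<-asym y<s s<y)
  where
  y<s : y < s
  y<s = <ᵇ⇒< y s (proj₁ (∧-split {y <ᵇ s} (proj₂ (cols-split R₁ (y ∷ R₂′) S₁ᵃ (s ∷ (S₁ᵇ ++ S₂)) (sym same-length)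
          (subst (λ Z → T (colsIncreasing (R₁ ++ y ∷ R₂′) Z)) (++-assoc S₁ᵃ (s ∷ S₁ᵇ) S₂) cols)))))
  s<y : s < y
  s<y = All-middle S₁ᵃ s S₁ᵇ S₁<y
bumpBound-next R₁ z R₂ R₂′ S y R₁<y z≤y cols S₁ S₂ refl S₁<y | no R₁-not-shorter
  with split-at-index (R₁ ++ [ z ]) (length S₁)
         (subst (length S₁ <_) (sym (length-snoc R₁ z)) (s≤s (≮⇒≥ R₁-not-shorter)))
... | P₁ , q , M , R₁z≡ , same-length = P₁ , q , M ++ R₂ , row≡ , same-length , q≤y
  where
  row≡ : R₁ ++ z ∷ R₂ ≡ P₁ ++ q ∷ (M ++ R₂)
  row≡ = trans (sym (++-assoc R₁ [ z ] R₂)) (trans (cong (_++ R₂) R₁z≡) (++-assoc P₁ (q ∷ M) R₂))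
  q≤y : q ≤ y
  q≤y = All-middle P₁ q M (subst (All (_≤ y)) R₁z≡ (AllP.++⁺ (All.map <⇒≤ R₁<y) (z≤y ∷ [])))

insertStep : ℕ → ℕ → ℕ → Tableau → List ℕ → Bool → Tableau
insertStep f r x P R true  = keepIfIncreasing P (setRow r (R ++ [ x ]) P)
insertStep f r x P R false = insertRow f (suc r) (smallestAbove x R)
  (keepIfIncreasing P (setRow r (map (λ e → if e ≡ᵇ smallestAbove x R then x else e) R) P))

insertRow-unfold : ∀ f r x P → insertRow (suc f) r x P ≡ insertStep f r x P (getRow r P) (allLeq x (getRow r P))
insertRow-unfold f r x P with allLeq x (getRow r P)
... | true  = refl
... | false = refl

entries-after-pair : ∀ R₁ x y R₂ → T (rowIncreasing (R₁ ++ x ∷ y ∷ R₂)) → All (y <_) R₂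
entries-after-pair R₁ x y R₂ rowR =
  proj₁ (row-tail-above y R₂ (proj₂ (row-tail-above x (y ∷ R₂) (row-suffix R₁ (x ∷ y ∷ R₂) rowR))))

insert-at-repeat : ∀ R₁ x y R₂ → T (rowIncreasing (R₁ ++ x ∷ y ∷ R₂)) → All (_< x) R₁ → x < y →
  allLeq x (R₁ ++ x ∷ y ∷ R₂) ≡ false × smallestAbove x (R₁ ++ x ∷ y ∷ R₂) ≡ y ×
  map (replaceBy x y) (R₁ ++ x ∷ y ∷ R₂) ≡ (R₁ ++ [ x ]) ++ x ∷ R₂
insert-at-repeat R₁ x y R₂ rowR R₁<x x<y =
  subst (λ Z → allLeq x Z ≡ false) R≡ (allLeq-fails x (R₁ ++ [ x ]) y R₂ x<y) ,
  subst (λ Z → smallestAbove x Z ≡ y) R≡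
    (smallestAbove-is x (R₁ ++ [ x ]) y R₂ (AllP.++⁺ (All.map <⇒≤ R₁<x) (≤-refl ∷ [])) x<y y<R₂) ,
  subst (λ Z → map (replaceBy x y) Z ≡ (R₁ ++ [ x ]) ++ x ∷ R₂) R≡
    (map-replaceBy x y (R₁ ++ [ x ]) R₂ (AllP.++⁺ (All.map (λ e<x → <-trans e<x x<y) R₁<x) (x<y ∷ [])) y<R₂)
  where
  R≡ : (R₁ ++ [ x ]) ++ y ∷ R₂ ≡ R₁ ++ x ∷ y ∷ R₂
  R≡ = ++-assoc R₁ [ x ] (y ∷ R₂)
  y<R₂ : All (y <_) R₂
  y<R₂ = entries-after-pair R₁ x y R₂ rowR

pendingWord : Tableau → List ℕ → ℕ → Tableau → List ℕ
pendingWord Above R x B = readingWord B ++ R ++ x ∷ readAbove Above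

mutual
  -- x arrives in the empty row below the tableau: it forms a new row, unless
  -- that is rejected, which by the invariant means x already ends the column.
  insert-new-row : ∀ fuel Above x → 0 < fuel → T (isIncreasing (stack Above [])) → BumpBoundAbove Above [] x →
    (x ∷ readAbove Above) ≈H readingWord (insertRow fuel (length Above) x (stack Above []))
  insert-new-row (suc f) Above x _ inc bound =
    subst (λ Z → (x ∷ readAbove Above) ≈H readingWord Z) (sym unfolded)
      (keepIfIncreasing-cases (stack Above []) (stack Above ((x ∷ []) ∷ []))
        (λ Z → (x ∷ readAbove Above) ≈H readingWord Z)
        (λ _ → ≡⇒≈H (sym (readingWord-stack Above ((x ∷ []) ∷ []))))
        (rejected Above inc bound))
    where
    unfolded : insertRow (suc f) (length Above) x (stack Above []) ≡
               keepIfIncreasing (stack Above []) (stack Above ((x ∷ []) ∷ []))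
    unfolded = trans (insertRow-unfold f (length Above) x (stack Above []))
      (trans (cong (λ Z → insertStep f (length Above) x (stack Above []) Z (allLeq x Z)) (getRow-current Above []))
             (cong (keepIfIncreasing (stack Above [])) (setRow-current Above (x ∷ []) [])))
    rejected : ∀ Above → T (isIncreasing (stack Above [])) → BumpBoundAbove Above [] x →
      isIncreasing (stack Above ((x ∷ []) ∷ [])) ≡ false → (x ∷ readAbove Above) ≈H readingWord (stack Above [])
    rejected []            _   _     not-inc = ⊥-elim (false-not-T not-inc tt)
    rejected (P ∷ Above′) inc bound not-inc with bound [] [] refl []
    ... | [] , q , Q , refl , _ , q≤x with m≤n⇒m<n∨m≡n q≤x
    ...   | inj₁ q<x =
      ⊥-elim (false-not-T not-inc (add-singleton-row Above′ (q ∷ Q) x inc (∧-join (<⇒<ᵇ q<x) tt)))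
    ...   | inj₂ refl =
      ≈trans (idem [] (Q ++ readAbove Above′) q) (≡⇒≈H (sym (readingWord-stack (P ∷ Above′) [])))

  -- y, bumped out of R (now part of the rows above), is inserted into the next row.
  insert-next-row : ∀ f Above R B y → suc (length B) ≤ f → T (isIncreasing (stack Above (R ∷ B))) →
    BumpBound R (firstRow B) y →
    (readingWord B ++ y ∷ R ++ readAbove Above) ≈H
      readingWord (insertRow f (suc (length Above)) y (stack Above (R ∷ B)))
  insert-next-row f Above R []      y fuel inc bound = insert-new-row f (R ∷ Above) y fuel inc bound
  insert-next-row f Above R (S ∷ B) y fuel inc bound =
    ≈trans (≡⇒≈H (++-assoc (readingWord B) S (y ∷ R ++ readAbove Above)))
           (insert-row f (R ∷ Above) S B y fuel inc bound)

  insert-row : ∀ fuel Above R B x → suc (length B) < fuel → T (isIncreasing (stack Above (R ∷ B))) →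
    BumpBoundAbove Above R x →
    pendingWord Above R x B ≈H readingWord (insertRow fuel (length Above) x (stack Above (R ∷ B)))
  insert-row (suc f) Above R B x (s≤s fuel) inc bound with current-row-facts Above R B inc
  ... | _ , rowR , above , below
    rewrite insertRow-unfold f (length Above) x (stack Above (R ∷ B)) | getRow-current Above (R ∷ B) =
    insert-row-cases f Above R B x fuel inc bound rowR above below (rowSplit x R rowR)

  -- The four cases: x is appended to R, or x equals the last entry of R, or
  -- x equals a non-last entry, or x bumps a larger entry y.
  insert-row-cases : ∀ f Above R B x → suc (length B) ≤ f → T (isIncreasing (stack Above (R ∷ B))) →
    BumpBoundAbove Above R x → T (rowIncreasing R) → CompatibleAbove Above R → CompatibleBelow R B → RowSplit x R →
    pendingWord Above R x B ≈H readingWord (insertStep f (length Above) x (stack Above (R ∷ B)) R (allLeq x R))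
  insert-row-cases f Above R B x fuel inc bound rowR above below (inj₁ R<x)
    rewrite allLeq-holds x R (All.map <⇒≤ R<x) | setRow-current Above (R ++ [ x ]) (R ∷ B) =
    keepIfIncreasing-cases (stack Above (R ∷ B)) (stack Above ((R ++ [ x ]) ∷ B))
      (λ Z → pendingWord Above R x B ≈H readingWord Z)
      (λ _ → ≡⇒≈H (begin
        readingWord B ++ R ++ x ∷ readAbove Above   ≡⟨ cong (readingWord B ++_) (sym (++-assoc R [ x ] (readAbove Above))) ⟩
        readingWord B ++ (R ++ [ x ]) ++ readAbove Above ≡⟨ sym (++-assoc (readingWord B) (R ++ [ x ]) (readAbove Above)) ⟩
        (readingWord B ++ R ++ [ x ]) ++ readAbove Above ≡⟨ sym (readingWord-stack Above ((R ++ [ x ]) ∷ B)) ⟩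
        readingWord (stack Above ((R ++ [ x ]) ∷ B))     ∎))
      (append-rejected Above R B x inc bound rowR above below R<x)
    where open ≡-Reasoning
  insert-row-cases f Above _ B x fuel inc bound rowR above below (inj₂ (R₁ , y , R₂ , refl , R₁<x , x≤y , y<R₂))
    with m≤n⇒m<n∨m≡n x≤y
  ... | inj₁ x<y = bump-strict f Above R₁ y R₂ B x fuel inc bound rowR above below R₁<x x<y y<R₂
  insert-row-cases f Above _ B x fuel inc bound rowR above below (inj₂ (R₁ , x , [] , refl , R₁<x , _ , _))
      | inj₂ refl = append-repeat f Above R₁ B x inc R₁<x
  insert-row-cases f Above _ B x fuel inc bound rowR above below (inj₂ (R₁ , x , y ∷ R₂ , refl , R₁<x , _ , x<y ∷ _))
      | inj₂ refl = bump-after-equal f Above R₁ x y R₂ B fuel inc rowR below R₁<x x<y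

  -- Appending x to R was rejected: then x equals the entry above its new box.
  append-rejected : ∀ Above R B x → T (isIncreasing (stack Above (R ∷ B))) → BumpBoundAbove Above R x →
    T (rowIncreasing R) → CompatibleAbove Above R → CompatibleBelow R B → All (_< x) R →
    isIncreasing (stack Above ((R ++ [ x ]) ∷ B)) ≡ false → pendingWord Above R x B ≈H readingWord (stack Above (R ∷ B))
  append-rejected [] R B x inc bound rowR above below R<x not-inc =
    ⊥-elim (false-not-T not-inc (replace-current-row [] R (R ++ [ x ]) B inc (nonEmpty-middle R x [])
      (row-join R x [] rowR R<x tt) tt (compatibleBelow-extend R [ x ] B below)))
  append-rejected (P ∷ Above′) R B x inc bound rowR above below R<x not-inc
    with bound R [] (sym (++-identityʳ R)) R<x
  ... | Q₁ , q , Q₂ , refl , same-length , q≤x = by-cases (m≤n⇒m<n∨m≡n q≤x)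
    where
    cols₁ : T (colsIncreasing Q₁ R)
    cols₁ = proj₁ (cols-split Q₁ (q ∷ Q₂) R [] same-length
                    (subst (λ Z → T (colsIncreasing (Q₁ ++ q ∷ Q₂) Z)) (sym (++-identityʳ R)) above))
    by-cases : q < x ⊎ q ≡ x → pendingWord (P ∷ Above′) R x B ≈H readingWord (stack (P ∷ Above′) (R ∷ B))
    by-cases (inj₁ q<x) = ⊥-elim (false-not-T not-inc (replace-current-row (P ∷ Above′) R (R ++ [ x ]) B inc
      (nonEmpty-middle R x []) (row-join R x [] rowR R<x tt)
      (cols-join Q₁ (q ∷ Q₂) R (x ∷ []) same-length cols₁ (∧-join (<⇒<ᵇ q<x) tt))
      (compatibleBelow-extend R [ x ] B below)))
    by-cases (inj₂ refl) =
      ≈trans (≈H-prefix (readingWord B) (absorb-above R q Q₁ Q₂ (readAbove Above′) (cols-far q Q₁ R same-length cols₁ R<x)))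
             (≡⇒≈H (trans (sym (++-assoc (readingWord B) R _)) (sym (readingWord-stack (P ∷ Above′) (R ∷ B)))))

  -- x equals the last entry of R: appending is never accepted, x x = x.
  append-repeat : ∀ f Above R₁ B x → T (isIncreasing (stack Above ((R₁ ++ x ∷ []) ∷ B))) → All (_< x) R₁ →
    pendingWord Above (R₁ ++ x ∷ []) x B ≈H
      readingWord (insertStep f (length Above) x (stack Above ((R₁ ++ x ∷ []) ∷ B))
                              (R₁ ++ x ∷ []) (allLeq x (R₁ ++ x ∷ [])))
  append-repeat f Above R₁ B x inc R₁<x
    rewrite allLeq-holds x (R₁ ++ x ∷ []) (AllP.++⁺ (All.map <⇒≤ R₁<x) (≤-refl ∷ []))
          | setRow-current Above ((R₁ ++ x ∷ []) ++ [ x ]) ((R₁ ++ x ∷ []) ∷ B) =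
    keepIfIncreasing-cases (stack Above ((R₁ ++ x ∷ []) ∷ B)) (stack Above (((R₁ ++ x ∷ []) ++ [ x ]) ∷ B))
      (λ Z → pendingWord Above (R₁ ++ x ∷ []) x B ≈H readingWord Z)
      (λ inc′ → ⊥-elim (row-no-repeat R₁ x []
        (subst (λ Z → T (rowIncreasing Z)) (++-assoc R₁ [ x ] [ x ]) (proj₁ (proj₂ (current-row-facts Above _ B inc′))))))
      (λ _ → ≈trans (≈H-prefix (readingWord B) (absorb-adjacent R₁ x (readAbove Above)))
        (≡⇒≈H (trans (sym (++-assoc (readingWord B) (R₁ ++ x ∷ []) (readAbove Above)))
                     (sym (readingWord-stack Above ((R₁ ++ x ∷ []) ∷ B))))))

  -- x equals an entry followed by y: replacing y by x would repeat x, so the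
  -- row is kept and y is bumped; the braid relation accounts for it.
  bump-after-equal : ∀ f Above R₁ x y R₂ B → suc (length B) ≤ f → T (isIncreasing (stack Above ((R₁ ++ x ∷ y ∷ R₂) ∷ B))) →
    T (rowIncreasing (R₁ ++ x ∷ y ∷ R₂)) → CompatibleBelow (R₁ ++ x ∷ y ∷ R₂) B → All (_< x) R₁ → x < y →
    pendingWord Above (R₁ ++ x ∷ y ∷ R₂) x B ≈H readingWord (insertStep f (length Above) x
      (stack Above ((R₁ ++ x ∷ y ∷ R₂) ∷ B)) (R₁ ++ x ∷ y ∷ R₂) (allLeq x (R₁ ++ x ∷ y ∷ R₂)))
  bump-after-equal f Above R₁ x y R₂ B fuel inc rowR below R₁<x x<y
    with insert-at-repeat R₁ x y R₂ rowR R₁<x x<y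
  ... | fails , bumped , replaced
    rewrite fails | bumped | replaced | setRow-current Above ((R₁ ++ [ x ]) ++ x ∷ R₂) ((R₁ ++ x ∷ y ∷ R₂) ∷ B) =
    keepIfIncreasing-cases (stack Above (R ∷ B)) (stack Above (((R₁ ++ [ x ]) ++ x ∷ R₂) ∷ B))
      (λ Z → pendingWord Above R x B ≈H readingWord (insertRow f (suc (length Above)) y Z))
      (λ inc′ → ⊥-elim (row-no-repeat R₁ x R₂
        (subst (λ Z → T (rowIncreasing Z)) (++-assoc R₁ [ x ] (x ∷ R₂)) (proj₁ (proj₂ (current-row-facts Above _ B inc′))))))
      (λ _ → ≈trans (≈H-prefix (readingWord B)
                      (bump-word-braid R₁ x y R₂ (readAbove Above) (far-below R₁ R₁<x x<y) (far-above R₂ x<y y<R₂)))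
                    (insert-next-row f Above R B y fuel inc next-bound))
    where
    R = R₁ ++ x ∷ y ∷ R₂
    R≡ : (R₁ ++ [ x ]) ++ y ∷ R₂ ≡ R
    R≡ = ++-assoc R₁ [ x ] (y ∷ R₂)
    y<R₂ : All (y <_) R₂
    y<R₂ = entries-after-pair R₁ x y R₂ rowR
    R₁x<y : All (_< y) (R₁ ++ [ x ])
    R₁x<y = AllP.++⁺ (All.map (λ e<x → <-trans e<x x<y) R₁<x) (x<y ∷ [])
    next-bound : BumpBound R (firstRow B) y
    next-bound = subst (λ Z → BumpBound Z (firstRow B) y) R≡
      (bumpBound-next (R₁ ++ [ x ]) y R₂ R₂ (firstRow B) y R₁x<y ≤-refl
        (subst (λ Z → T (colsIncreasing Z (firstRow B))) (sym R≡) (compatibleBelow-firstRow R B below)))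

  -- If the replacement is rejected, the entry
  -- above is x itself; it absorbs x and y is duplicated in front of the row.
  bump-strict : ∀ f Above R₁ y R₂ B x → suc (length B) ≤ f → T (isIncreasing (stack Above ((R₁ ++ y ∷ R₂) ∷ B))) →
    BumpBoundAbove Above (R₁ ++ y ∷ R₂) x → T (rowIncreasing (R₁ ++ y ∷ R₂)) → CompatibleAbove Above (R₁ ++ y ∷ R₂) →
    CompatibleBelow (R₁ ++ y ∷ R₂) B → All (_< x) R₁ → x < y → All (y <_) R₂ →
    pendingWord Above (R₁ ++ y ∷ R₂) x B ≈H readingWord (insertStep f (length Above) x
      (stack Above ((R₁ ++ y ∷ R₂) ∷ B)) (R₁ ++ y ∷ R₂) (allLeq x (R₁ ++ y ∷ R₂)))
  bump-strict f Above R₁ y R₂ B x fuel inc bound rowR above below R₁<x x<y y<R₂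
    rewrite allLeq-fails x R₁ y R₂ x<y | smallestAbove-is x R₁ y R₂ (All.map <⇒≤ R₁<x) x<y y<R₂
          | map-replaceBy x y R₁ R₂ (All.map (λ e<x → <-trans e<x x<y) R₁<x) y<R₂
          | setRow-current Above (R₁ ++ x ∷ R₂) ((R₁ ++ y ∷ R₂) ∷ B) =
    keepIfIncreasing-cases (stack Above ((R₁ ++ y ∷ R₂) ∷ B)) (stack Above ((R₁ ++ x ∷ R₂) ∷ B))
      (λ Z → pendingWord Above (R₁ ++ y ∷ R₂) x B ≈H readingWord (insertRow f (suc (length Above)) y Z))
      (λ inc′ → ≈trans (≈H-prefix (readingWord B)
                         (bump-word R₁ y R₂ x (readAbove Above) (far-below R₁ R₁<x x<y) (far-above R₂ x<y y<R₂)))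
                       (insert-next-row f Above (R₁ ++ x ∷ R₂) B y fuel inc′
                         (bumpBound-next R₁ x R₂ R₂ (firstRow B) y R₁<y (<⇒≤ x<y) (compatibleBelow-firstRow _ B below))))
      (rejected Above inc bound above)
    where
    R₁<y : All (_< y) R₁
    R₁<y = All.map (λ e<x → <-trans e<x x<y) R₁<x
    rowR′ : T (rowIncreasing (R₁ ++ x ∷ R₂))
    rowR′ = row-join R₁ x R₂ (row-prefix R₁ (y ∷ R₂) rowR) R₁<x
              (row-lower-head y x R₂ (<⇒≤ x<y) (row-suffix R₁ (y ∷ R₂) rowR))
    below′ : CompatibleBelow (R₁ ++ x ∷ R₂) B
    below′ = compatibleBelow-lower R₁ y x R₂ B (<⇒≤ x<y) below
    rejected : ∀ Above → T (isIncreasing (stack Above ((R₁ ++ y ∷ R₂) ∷ B))) → BumpBoundAbove Above (R₁ ++ y ∷ R₂) x →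
      CompatibleAbove Above (R₁ ++ y ∷ R₂) → isIncreasing (stack Above ((R₁ ++ x ∷ R₂) ∷ B)) ≡ false →
      pendingWord Above (R₁ ++ y ∷ R₂) x B ≈H
        readingWord (insertRow f (suc (length Above)) y (stack Above ((R₁ ++ y ∷ R₂) ∷ B)))
    rejected [] inc bound above not-inc =
      ⊥-elim (false-not-T not-inc (replace-current-row [] _ (R₁ ++ x ∷ R₂) B inc (nonEmpty-middle R₁ x R₂) rowR′ tt below′))
    rejected (P ∷ Above′) inc bound above not-inc with bound R₁ (y ∷ R₂) refl R₁<x
    ... | Q₁ , q , Q₂ , refl , same-length , q≤x = by-cases (m≤n⇒m<n∨m≡n q≤x)
      where
      cols = cols-split Q₁ (q ∷ Q₂) R₁ (y ∷ R₂) same-length above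
      by-cases : q < x ⊎ q ≡ x → pendingWord (P ∷ Above′) (R₁ ++ y ∷ R₂) x B ≈H
        readingWord (insertRow f (suc (length (P ∷ Above′))) y (stack (P ∷ Above′) ((R₁ ++ y ∷ R₂) ∷ B)))
      by-cases (inj₁ q<x) = ⊥-elim (false-not-T not-inc (replace-current-row (P ∷ Above′) _ (R₁ ++ x ∷ R₂) B inc
        (nonEmpty-middle R₁ x R₂) rowR′
        (cols-join Q₁ (q ∷ Q₂) R₁ (x ∷ R₂) same-length (proj₁ cols)
          (∧-join (<⇒<ᵇ q<x) (proj₂ (∧-split {q <ᵇ y} (proj₂ cols)))))
        below′))
      by-cases (inj₂ refl) =
        ≈trans (≈H-prefix (readingWord B)
                 (absorb-above (R₁ ++ y ∷ R₂) q Q₁ Q₂ (readAbove Above′) (cols-far q Q₁ R₁ same-length (proj₁ cols) R₁<x)))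
        (≈trans (≈H-prefix (readingWord B)
                  (duplicate-front R₁ y R₂ ((Q₁ ++ q ∷ Q₂) ++ readAbove Above′) (far-below R₁ R₁<x x<y)))
                (insert-next-row f (P ∷ Above′) (R₁ ++ y ∷ R₂) B y fuel inc
                  (bumpBound-next R₁ y R₂ R₂ (firstRow B) y R₁<y ≤-refl (compatibleBelow-firstRow _ B below))))

heckeInsert-readingWord : ∀ P x → T (isIncreasing P) → (readingWord P ++ [ x ]) ≈H readingWord (heckeInsert P x)
heckeInsert-readingWord []      x _   = insert-new-row 1 [] x (s≤s z≤n) tt tt
heckeInsert-readingWord (R ∷ B) x inc =
  ≈trans (≡⇒≈H (++-assoc (readingWord B) R [ x ])) (insert-row (2 + length B) [] R B x ≤-refl inc tt)

keepIfIncreasing-increasing : ∀ P P′ → T (isIncreasing P) → T (isIncreasing (keepIfIncreasing P P′))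
keepIfIncreasing-increasing P P′ inc = keepIfIncreasing-cases P P′ (λ Z → T (isIncreasing Z)) (λ inc′ → inc′) (λ _ → inc)

insertRow-increasing : ∀ fuel r x P → T (isIncreasing P) → T (isIncreasing (insertRow fuel r x P))
insertRow-increasing zero    r x P inc = inc
insertRow-increasing (suc f) r x P inc with allLeq x (getRow r P)
... | true  = keepIfIncreasing-increasing P (setRow r (getRow r P ++ [ x ]) P) inc
... | false = insertRow-increasing f (suc r) _ _ (keepIfIncreasing-increasing P (setRow r replaced P) inc)
  where
  replaced = map (λ e → if e ≡ᵇ smallestAbove x (getRow r P) then x else e) (getRow r P)

insertWord : ∀ P w → T (isIncreasing P) →
  T (isIncreasing (foldl heckeInsert P w)) × (readingWord P ++ w) ≈H readingWord (foldl heckeInsert P w)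
insertWord P []      inc = inc , ≡⇒≈H (++-identityʳ (readingWord P))
insertWord P (x ∷ w) inc with insertWord (heckeInsert P x) w (insertRow-increasing (suc (length P)) 0 x P inc)
... | inc′ , equiv =
  inc′ ,
  (readingWord P ++ x ∷ w               ≡≈⟨ sym (++-assoc (readingWord P) [ x ] w) ⟩
   (readingWord P ++ [ x ]) ++ w        ≈⟨ ≈H-suffix w (heckeInsert-readingWord P x inc) ⟩
   readingWord (heckeInsert P x) ++ w   ≈⟨ equiv ⟩
   readingWord (foldl heckeInsert (heckeInsert P x) w) ≈∎)

-- (G) The theorem

heckeTableau-facts : ∀ w → T (isIncreasing (heckeTableau w)) × w ≈H readingWord (heckeTableau w)
heckeTableau-facts w = insertWord [] w tt

size-readingWord : ∀ P → length (readingWord P) ≡ size P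
size-readingWord []      = refl
size-readingWord (R ∷ P) =
  trans (length-++ (readingWord P))
        (trans (+-comm (length (readingWord P)) (length R)) (cong (length R +_) (size-readingWord P)))

shape-staircaseTableau : ∀ m n → map length (staircaseTableau m n) ≡ staircase n
shape-staircaseTableau m zero    = refl
shape-staircaseTableau m (suc n) = cong₂ _∷_ (length-range m (suc n)) (shape-staircaseTableau (suc m) n)

sum-staircase : ∀ q → sum (staircase q) ≡ triangle q
sum-staircase zero    = refl
sum-staircase (suc q) = cong (suc q +_) (sum-staircase q)

heckeTableau-size : ∀ q w → InAlphabet q w →
  size (heckeTableau w) ≤ triangle q × (triangle q ≤ size (heckeTableau w) → heckeTableau w ≡ staircaseTableau 1 q)
heckeTableau-size q w alph =
  increasing-tableau-size P 1 q (proj₁ (heckeTableau-facts w)) (first-row-positive P rows)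
    (All.map (All.map (λ (_ , a≤q) → s≤s a≤q)) rows)
  where
  P = heckeTableau w
  rows : All (All (λ a → 1 ≤ a × a ≤ q)) P
  rows = All-readingWord⁻ P (≈H-preserves-All (proj₂ (heckeTableau-facts w)) alph)
  first-row-positive : ∀ P → All (All (λ a → 1 ≤ a × a ≤ q)) P → FirstRowFrom 1 P
  first-row-positive []      _       = tt
  first-row-positive (R ∷ _) (r ∷ _) = All.map proj₁ r

-- A reduced word of w₀ is as long as w₀ has inversions, so each letter adds
-- one inversion and its Demazure action also produces w₀.
reduced-longest-demazure : ∀ q v → Reduced q v → permOf q v ≡ longestPerm q →
  demazure (identityPerm q) v ≡ longestPerm q
reduced-longest-demazure q v (_ , minimal) v-w₀ =
  trans (sym (proj₂ (inversions-permAct (identityPerm q) v) tight)) v-w₀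
  where
  short : length v ≤ triangle q
  short with length v ≤? triangle q
  ... | yes v≤ = v≤
  ... | no  v≰ = ⊥-elim (minimal (longestWord q) (longestWord-alphabet q)
                   (subst (_< length v) (sym (length-longestWord q)) (≰⇒> v≰))
                   (trans (permOf-longestWord q) (sym v-w₀)))
  tight : inversions (permOf q v) ≡ inversions (identityPerm q) + length v
  tight = begin
    inversions (permOf q v)               ≡⟨ cong inversions v-w₀ ⟩
    inversions (longestPerm q)            ≡⟨ inversions-longestPerm q ⟩
    triangle q                            ≡⟨ ≤-antisym (longestPerm-length q v v-w₀) short ⟩
    length v                              ≡⟨ cong (_+ length v) (sym (inversions-identityPerm q)) ⟩
    inversions (identityPerm q) + length v ∎
    where open ≡-Reasoning

demazure-longest-length : ∀ q u → demazure (identityPerm q) u ≡ longestPerm q → triangle q ≤ length u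
demazure-longest-length q u u-w₀ =
  subst₂ _≤_ (trans (cong inversions u-w₀) (inversions-longestPerm q)) (cong (_+ length u) (inversions-identityPerm q))
    (inversions-demazure (identityPerm q) u)

longest-readingWord-demazure : ∀ q w → InAlphabet q w → WisLongest q w →
  demazure (identityPerm q) (readingWord (heckeTableau w)) ≡ longestPerm q
longest-readingWord-demazure q w alph (v , reduced , v-w₀ , w≈v) = begin
  demazure (identityPerm q) (readingWord (heckeTableau w))
    ≡⟨ sym (demazure-respects-≈H (proj₂ (heckeTableau-facts w)) positive (identityPerm q)) ⟩
  demazure (identityPerm q) w ≡⟨ demazure-respects-≈H w≈v positive (identityPerm q) ⟩
  demazure (identityPerm q) v ≡⟨ reduced-longest-demazure q v reduced v-w₀ ⟩
  longestPerm q               ∎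
  where
  open ≡-Reasoning
  positive : Positive w
  positive = All.map proj₁ alph

lemma5p1 : (q : ℕ) (w : List ℕ) → InAlphabet q w →
    (heckeShape w ≡ staircase q) ⇔ WisLongest q w
lemma5p1 q w alph = mk⇔ staircase⇒longest longest⇒staircase
  where
  P = heckeTableau w
  P-is-staircase : triangle q ≤ size P → P ≡ staircaseTableau 1 q
  P-is-staircase = proj₂ (heckeTableau-size q w alph)
  -- a staircase shape has q(q+1)/2 boxes, so P is the staircase tableau
  staircase⇒longest : heckeShape w ≡ staircase q → WisLongest q w
  staircase⇒longest shape =
    longestWord q , longestWord-reduced q , permOf-longestWord q ,
    subst (w ≈H_) (cong readingWord (P-is-staircase full)) (proj₂ (heckeTableau-facts w))
    where
    full : triangle q ≤ size P
    full = ≤-reflexive (trans (sym (sum-staircase q)) (cong sum (sym shape)))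
  -- read P acts as w₀, so P has at least q(q+1)/2 boxes
  longest⇒staircase : WisLongest q w → heckeShape w ≡ staircase q
  longest⇒staircase longest = trans (cong (map length) (P-is-staircase full)) (shape-staircaseTableau 1 q)
    where
    full : triangle q ≤ size P
    full = subst (triangle q ≤_) (size-readingWord P)
             (demazure-longest-length q (readingWord P) (longest-readingWord-demazure q w alph longest))
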